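{- For all terms $M,N$ of the $\partial_0\lambda$-calculus with tests and every repetition-free list of variables $\vec x$ containing the free variables of $M$ and $N$: $$\llbracket M\rrbracket_{\vec x}\subseteq\llbracket N\rrbracket_{\vec x}\iff M\sqsubseteq^{\tau}_{\mathcal O} N.$$ (That is, the relational model $\mathcal D$ is inequationally fully abstract for the $\partial_0\lambda$-calculus with tests.)
   Context: Syntax of the $\partial_0\lambda$-calculus with tests. Terms $M,N,L$, bags $P$ and tests $V,W$ are given by $M ::= x \mid \lambda x.M \mid MP \mid \bar\tau(V)$, $P ::= [L_1,\dots,L_k]$, $V ::= \tau[L_1,\dots,L_k]$ ($k\ge 0$), where bags and tests are finite multisets of terms (the tag $\tau$ distinguishes tests from bags); expressions (terms, bags, tests) are taken up to $\alpha$-equivalence. $\uplus$ denotes union of bags; for tests, $\varepsilon:=\tau[\,]$ and $V\mid W$ is multiset union. For each sort, sums are finite formal sums with idempotent addition (equivalently finite sets), $0$ being the empty sum. All constructors are extended to sums by multilinearity (e.g. $\lambda x.\sum_i M_i=\sum_i\lambda x.M_i$, $(\sum_i M_i)(\sum_j P_j)=\sum_{i,j}M_iP_j$, $[\sum_i L_i]\uplus P=\sum_i[L_i]\uplus P$, $\tau[\sum_iM_i]\mid V=\sum_i\tau[M_i]\mid V$); in particular any constructor applied to $0$ gives $0$. $A\{N/x\}$ is capture-avoiding substitution, extended to sums by these conventions (so $A\{0/x\}=0$ if $x$ is free in $A$, and $A\{0/x\}=A$ otherwise). Linear substitution: $x\langle N/x\rangle=N$; $y\langle N/x\rangle=0$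 for $y\neq x$; $(\lambda y.M)\langle N/x\rangle=\lambda y.M\langle N/x\rangle$; $(MP)\langle N/x\rangle=M\langle N/x\rangle P+M(P\langle N/x\rangle)$; $\bar\tau(V)\langle N/x\rangle=\bar\tau(V\langle N/x\rangle)$; $[L_1,\dots,L_k]\langle N/x\rangle=\sum_{i=1}^k[L_1,\dots,L_i\langle N/x\rangle,\dots,L_k]$ and likewise for tests; extended linearly to sums. For a bag $P=[L_1,\dots,L_k]$ with $x$ not free in $P$, $A\langle P/x\rangle:=A\langle L_1/x\rangle\cdots\langle L_k/x\rangle$ (independent of the order). Reduction: base rules $(\lambda x.M)P\to M\langle P/x\rangle\{0/x\}$ ($x$ not free in $P$); $\bar\tau(V)P\to\bar\tau(V)$ if $P=[\,]$ and $\bar\tau(V)P\to 0$ otherwise; $\tau[\lambda x.M]\mid V\to\tau[M\{0/x\}]\mid V$; $\tau[\bar\tau(V)]\mid W\to V\mid W$. The relation $\to$ on sums is the closure of these rules under every syntactic position (body of a $\lambda$, either side of an application, an element of a bag, inside $\bar\tau$, an element of a test) and under sums ($A+\mathbb B\to\mathbb A+\mathbb B$ if $A\to\mathbb A$); $\twoheadrightarrow$ is its reflexive-transitive closure. Contexts and preorder. Term-contexts $D ::= [\cdot]\mid\lambda x.D\mid DP\mid M[D,L_1,\dots,L_k]\mid\bar\tau(C)$ and test-contexts $C::=\tau[D,L_1,\dots,L_k]$; $C[M]$ is obtained by replacing the hole by $M$, allowing capture. $M\sqsubseteq^{\tau}_{\mathcal O}N$ iff for every test-context $C$ such that $C[M]$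 and $C[N]$ are closed, $C[M]\twoheadrightarrow\varepsilon$ implies $C[N]\twoheadrightarrow\varepsilon$. The model $\mathcal D$. For a set $S$, $\mathcal M_f(S)$ is the set of finite multisets over $S$. Let $D_0=\emptyset$, $D_{n+1}$ the set of $\mathbb N$-indexed sequences $(a_1,a_2,\dots)$ of elements of $\mathcal M_f(D_n)$ with $a_i=[\,]$ for all but finitely many $i$, and $\mathcal D=\bigcup_n D_n$. For $a\in\mathcal M_f(\mathcal D)$ and $\alpha=(a_1,a_2,\dots)\in\mathcal D$, $a::\alpha:=(a,a_1,a_2,\dots)$; $*:=([\,],[\,],\dots)$. $\uplus$ on tuples of multisets is componentwise. For a repetition-free list $\vec x=x_1,\dots,x_n$ containing the free variables, define $\llbracket M\rrbracket_{\vec x}\subseteq\mathcal M_f(\mathcal D)^n\times\mathcal D$, $\llbracket P\rrbracket_{\vec x}\subseteq\mathcal M_f(\mathcal D)^n\times\mathcal M_f(\mathcal D)$, $\llbracket V\rrbracket_{\vec x}\subseteq\mathcal M_f(\mathcal D)^n$ by: $\llbracket x_i\rrbracket_{\vec x}=\{(([\,],\dots,[\alpha],\dots,[\,]),\alpha):\alpha\in\mathcal D\}$ ($[\alpha]$ in position $i$); $\llbracket\lambda y.M\rrbracket_{\vec x}=\{(\vec a,b::\alpha):((\vec a,b),\alpha)\in\llbracket M\rrbracket_{\vec x,y}\}$ ($y\notin\vec x$); $\llbracket MP\rrbracket_{\vec x}=\{(\vec a_1\uplus\vec a_2,\alpha):\exists b\,(\vec a_1,b::\alpha)\in\llbracket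 M\rrbracket_{\vec x},(\vec a_2,b)\in\llbracket P\rrbracket_{\vec x}\}$; $\llbracket\bar\tau(V)\rrbracket_{\vec x}=\{(\vec a,*):\vec a\in\llbracket V\rrbracket_{\vec x}\}$; $\llbracket[L_1,\dots,L_k]\rrbracket_{\vec x}=\{(\biguplus_i\vec a_i,[\beta_1,\dots,\beta_k]):(\vec a_i,\beta_i)\in\llbracket L_i\rrbracket_{\vec x}\}$; $\llbracket\tau[L_1,\dots,L_k]\rrbracket_{\vec x}=\{\biguplus_i\vec a_i:(\vec a_i,*)\in\llbracket L_i\rrbracket_{\vec x}\}$; the interpretation of a sum is the union of the interpretations of its summands. -}

module Defs where

open import Data.Nat using (ℕ; zero; suc)
open import Data.Fin using (Fin; zero; suc; _≟_)
open import Data.Maybe using (Maybe; just; nothing; _>>=_) renaming (map to mapMaybe′)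
open import Data.List using (List; []; _∷_; _++_; map; concatMap; mapMaybe)
open import Data.List.Relation.Unary.All using (All)
open import Data.List.Relation.Unary.Any using (Any)
open import Data.Vec using (Vec; lookup; tabulate; zipWith; replicate)
open import Data.Product using (Σ; ∃; _×_; _,_)
open import Data.Bool using (if_then_else_)
open import Relation.Nullary using (does)
open import Relation.Binary.PropositionalEquality using (_≡_)
open import Relation.Binary.Construct.Closure.ReflexiveTransitive using (Star)

-- Syntax (well-scoped de Bruijn: Term n has free variables among Fin n,
-- so α-equivalence is built in). Bags and tests are finite multisets of
-- terms, represented by lists (taken up to permutation where relevant).

data Term (n : ℕ) : Set where
  var  : Fin n → Term n
  lam  : Term (suc n) → Term n
  app  : Term n → List (Term n) → Term n
  tbar : List (Term n) → Term n

Bag : ℕ → Set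
Bag n = List (Term n)

Test : ℕ → Set
Test n = List (Term n)

ε : ∀ {n} → Test n
ε = []

mutual
  data _≈T_ {n : ℕ} : Term n → Term n → Set where
    var  : ∀ i → var i ≈T var i
    lam  : ∀ {M M'} → M ≈T M' → lam M ≈T lam M'
    app  : ∀ {M M' P P'} → M ≈T M' → P ≈L P' → app M P ≈T app M' P'
    tbar : ∀ {V V'} → V ≈L V' → tbar V ≈T tbar V'

  data _≈L_ {n : ℕ} : List (Term n) → List (Term n) → Set where
    []    : [] ≈L []
    _∷_   : ∀ {L L' P P'} → L ≈T L' → P ≈L P' → (L ∷ P) ≈L (L' ∷ P')
    swap  : ∀ {L L' P} → (L ∷ L' ∷ P) ≈L (L' ∷ L ∷ P)
    trans : ∀ {P Q R} → P ≈L Q → Q ≈L R → P ≈L R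

liftR : ∀ {m k} → (Fin m → Fin k) → Fin (suc m) → Fin (suc k)
liftR ρ zero    = zero
liftR ρ (suc i) = suc (ρ i)

mutual
  ren : ∀ {m k} → (Fin m → Fin k) → Term m → Term k
  ren ρ (var i)   = var (ρ i)
  ren ρ (lam M)   = lam (ren (liftR ρ) M)
  ren ρ (app M P) = app (ren ρ M) (renL ρ P)
  ren ρ (tbar V)  = tbar (renL ρ V)

  renL : ∀ {m k} → (Fin m → Fin k) → List (Term m) → List (Term k)
  renL ρ []      = []
  renL ρ (L ∷ P) = ren ρ L ∷ renL ρ P

wk : ∀ {n} → Term n → Term (suc n)
wk = ren suc

-- partial renamings: fail (nothing) if a variable outside the domain is free
liftM : ∀ {m k} → (Fin m → Maybe (Fin k)) → Fin (suc m) → Maybe (Fin (suc k))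
liftM ρ zero    = just zero
liftM ρ (suc i) = mapMaybe′ suc (ρ i)

mutual
  mren : ∀ {m k} → (Fin m → Maybe (Fin k)) → Term m → Maybe (Term k)
  mren ρ (var i)   = mapMaybe′ var (ρ i)
  mren ρ (lam M)   = mapMaybe′ lam (mren (liftM ρ) M)
  mren ρ (app M P) = mren ρ M >>= λ M' → mapMaybe′ (app M') (mrenL ρ P)
  mren ρ (tbar V)  = mapMaybe′ tbar (mrenL ρ V)

  mrenL : ∀ {m k} → (Fin m → Maybe (Fin k)) → List (Term m) → Maybe (List (Term k))
  mrenL ρ []      = just []
  mrenL ρ (L ∷ P) = mren ρ L >>= λ L' → mapMaybe′ (L' ∷_) (mrenL ρ P)

thick : ∀ {n} → Fin (suc n) → Maybe (Fin n)
thick zero    = nothing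
thick (suc i) = just i

-- M{0/x} for x = variable 0: nothing (the empty sum 0) if x is free in M,
-- otherwise M itself (in the smaller scope)
sub0 : ∀ {n} → Term (suc n) → Maybe (Term n)
sub0 = mren thick

-- Linear substitution M⟨N/x⟩ (sums = lists of summands)

mutual
  lsub : ∀ {n} → Fin n → Term n → Term n → List (Term n)
  lsub x (var y)   N = if does (x ≟ y) then N ∷ [] else []
  lsub x (lam M)   N = map lam (lsub (suc x) M (wk N))
  lsub x (app M P) N = map (λ M' → app M' P) (lsub x M N) ++ map (app M) (lsubL x P N)
  lsub x (tbar V)  N = map tbar (lsubL x V N)

  lsubL : ∀ {n} → Fin n → List (Term n) → Term n → List (List (Term n))
  lsubL x []      N = []
  lsubL x (L ∷ P) N = map (_∷ P) (lsub x L N) ++ map (L ∷_) (lsubL x P N)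

-- M⟨P/x⟩ for x = variable 0 and P a bag (x not free in P)
lsubBag : ∀ {n} → List (Term (suc n)) → Bag n → List (Term (suc n))
lsubBag Ms []      = Ms
lsubBag Ms (L ∷ P) = lsubBag (concatMap (λ M → lsub zero M (wk L)) Ms) P

mutual
  data _⟶t_ {n : ℕ} : Term n → List (Term n) → Set where
    beta   : ∀ M P → app (lam M) P ⟶t mapMaybe sub0 (lsubBag (M ∷ []) P)
    tnil   : ∀ V → app (tbar V) [] ⟶t (tbar V ∷ [])
    tcons  : ∀ V L P → app (tbar V) (L ∷ P) ⟶t []
    clam   : ∀ {M Ms} → M ⟶t Ms → lam M ⟶t map lam Ms
    cappL  : ∀ {M Ms} P → M ⟶t Ms → app M P ⟶t map (λ M' → app M' P) Ms
    cappR  : ∀ M {P Ps} → P ⟶b Ps → app M P ⟶t map (app M) Ps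
    ctbar  : ∀ {V Vs} → V ⟶v Vs → tbar V ⟶t map tbar Vs

  data _⟶b_ {n : ℕ} : Bag n → List (Bag n) → Set where
    celem : ∀ Q {L Ls} R → L ⟶t Ls → (Q ++ L ∷ R) ⟶b map (λ L' → Q ++ L' ∷ R) Ls

  data _⟶v_ {n : ℕ} : Test n → List (Test n) → Set where
    tlam  : ∀ Q M R → (Q ++ lam M ∷ R) ⟶v
              mapMaybe (λ M' → just (Q ++ M' ∷ R)) (mapMaybe sub0 (M ∷ []))
    ttbar : ∀ Q V R → (Q ++ tbar V ∷ R) ⟶v ((V ++ Q ++ R) ∷ [])
    celem : ∀ Q {L Ls} R → L ⟶t Ls → (Q ++ L ∷ R) ⟶v map (λ L' → Q ++ L' ∷ R) Ls

-- Sums of closed tests: finite sets (idempotent sums) of tests up to ≈L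

_⊆S_ : List (Test 0) → List (Test 0) → Set
S ⊆S T = All (λ A → Any (λ B → A ≈L B) T) S

_≈S_ : List (Test 0) → List (Test 0) → Set
S ≈S T = S ⊆S T × T ⊆S S

_⟶_ : List (Test 0) → List (Test 0) → Set
S ⟶ T = Σ (Test 0) λ A → Σ (List (Test 0)) λ As → Σ (List (Test 0)) λ B →
          S ≈S (A ∷ B) × A ⟶v As × T ≈S (As ++ B)

_↠_ : List (Test 0) → List (Test 0) → Set
_↠_ = Star _⟶_

Converges : Test 0 → Set
Converges V = Σ (List (Test 0)) λ T → (V ∷ []) ↠ T × T ≈S (ε ∷ [])

-- Contexts. TCtx n m : term-context in scope n whose hole is in scope m
-- (the hole may be under binders: capture allowed). VCtx: test-contexts.

mutual
  data TCtx : ℕ → ℕ → Set where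
    hole : ∀ {n} → TCtx n n
    lam  : ∀ {n m} → TCtx (suc n) m → TCtx n m
    appL : ∀ {n m} → TCtx n m → Bag n → TCtx n m
    appR : ∀ {n m} → Term n → TCtx n m → List (Term n) → TCtx n m
    tbar : ∀ {n m} → VCtx n m → TCtx n m

  data VCtx : ℕ → ℕ → Set where
    τctx : ∀ {n m} → TCtx n m → List (Term n) → VCtx n m

mutual
  plugT : ∀ {n m} → TCtx n m → Term m → Term n
  plugT hole           M = M
  plugT (lam D)        M = lam (plugT D M)
  plugT (appL D P)     M = app (plugT D M) P
  plugT (appR M' D Ls) M = app M' (plugT D M ∷ Ls)
  plugT (tbar C)       M = tbar (plugV C M)

  plugV : ∀ {n m} → VCtx n m → Term m → Test n
  plugV (τctx D Ls) M = plugT D M ∷ Ls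

-- The free variables of M, N : Term m (the list x⃗)
-- are mapped into the hole's scope by a partial injective map ρ (x_i is
-- bound by the innermost binder of the hole named x_i); C[M], C[N] closed
-- means exactly that ρ is defined on all free variables of M and N.
InjectiveWhereDefined : ∀ {m k} → (Fin m → Maybe (Fin k)) → Set
InjectiveWhereDefined ρ = ∀ i j l → ρ i ≡ just l → ρ j ≡ just l → i ≡ j

_⊑τ_ : ∀ {m} → Term m → Term m → Set
_⊑τ_ {m} M N = ∀ {k} (ρ : Fin m → Maybe (Fin k)) → InjectiveWhereDefined ρ →
  ∀ (M' N' : Term k) → mren ρ M ≡ just M' → mren ρ N ≡ just N' →
  (C : VCtx 0 k) → Converges (plugV C M') → Converges (plugV C N')

-- The relational model 𝒟: elements are finite sequences of finite
-- multisets (trailing empty multisets omitted = the "eventually [ ]"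
-- N-indexed sequences), up to the equivalence below.

data 𝒟 : Set where
  seq : List (List 𝒟) → 𝒟

mutual
  data _≈D_ : 𝒟 → 𝒟 → Set where
    seq : ∀ {s t} → s ≈Sq t → seq s ≈D seq t

  -- equality of N-indexed sequences (missing entries are [ ])
  data _≈Sq_ : List (List 𝒟) → List (List 𝒟) → Set where
    []   : [] ≈Sq []
    _∷_  : ∀ {a b s t} → a ≈M b → s ≈Sq t → (a ∷ s) ≈Sq (b ∷ t)
    padL : ∀ {s} → s ≈Sq [] → ([] ∷ s) ≈Sq []
    padR : ∀ {t} → [] ≈Sq t → [] ≈Sq ([] ∷ t)

  data _≈M_ : List 𝒟 → List 𝒟 → Set where
    []    : [] ≈M []
    _∷_   : ∀ {α β a b} → α ≈D β → a ≈M b → (α ∷ a) ≈M (β ∷ b)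
    swap  : ∀ {α β a} → (α ∷ β ∷ a) ≈M (β ∷ α ∷ a)
    trans : ∀ {a b c} → a ≈M b → b ≈M c → a ≈M c

_∷D_ : List 𝒟 → 𝒟 → 𝒟
a ∷D seq s = seq (a ∷ s)

⋆ : 𝒟
⋆ = seq []

Env : ℕ → Set
Env n = Vec (List 𝒟) n

_≈E_ : ∀ {n} → Env n → Env n → Set
as ≈E bs = ∀ i → lookup as i ≈M lookup bs i

_⊎E_ : ∀ {n} → Env n → Env n → Env n
_⊎E_ = zipWith _++_

emptyE : ∀ {n} → Env n
emptyE = replicate _ []

singleE : ∀ {n} → Fin n → 𝒟 → Env n
singleE i α = tabulate λ j → if does (i ≟ j) then α ∷ [] else []

-- Interpretation. Variable 0 of a Term (suc n) is the most recently bound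
-- variable (the y of λy.M), stored at index 0 of the environment.
mutual
  ⟦_⟧ : ∀ {n} → Term n → Env n → 𝒟 → Set
  ⟦ var i ⟧   as α = as ≈E singleE i α
  ⟦ lam M ⟧   as β = Σ (List 𝒟) λ b → Σ 𝒟 λ α → β ≈D (b ∷D α) × ⟦ M ⟧ (b Data.Vec.∷ as) α
  ⟦ app M P ⟧ as α = Σ (Env _) λ as₁ → Σ (Env _) λ as₂ → Σ (List 𝒟) λ b →
                       as ≈E (as₁ ⊎E as₂) × ⟦ M ⟧ as₁ (b ∷D α) × ⟦ P ⟧b as₂ b
  ⟦ tbar V ⟧  as α = α ≈D ⋆ × ⟦ V ⟧v as

  ⟦_⟧b : ∀ {n} → Bag n → Env n → List 𝒟 → Set
  ⟦ [] ⟧b    as b = as ≈E emptyE × b ≈M []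
  ⟦ L ∷ P ⟧b as b = Σ (Env _) λ as₁ → Σ (Env _) λ as₂ → Σ 𝒟 λ β → Σ (List 𝒟) λ b' →
                      as ≈E (as₁ ⊎E as₂) × ⟦ L ⟧ as₁ β × ⟦ P ⟧b as₂ b' × b ≈M (β ∷ b')

  ⟦_⟧v : ∀ {n} → Test n → Env n → Set
  ⟦ [] ⟧v    as = as ≈E emptyE
  ⟦ L ∷ V ⟧v as = Σ (Env _) λ as₁ → Σ (Env _) λ as₂ →
                    as ≈E (as₁ ⊎E as₂) × ⟦ L ⟧ as₁ ⋆ × ⟦ V ⟧v as₂

_⊆⟦⟧_ : ∀ {n} → Term n → Term n → Set
M ⊆⟦⟧ N = ∀ as α → ⟦ M ⟧ as α → ⟦ N ⟧ as α

-- Both directions rest on adequacy: a closed test converges to ε iff its interpretation is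
-- non-empty. The interpretation is invariant under every reduction step (the substance being
-- the linear substitution lemma: the points of M⟨N/x⟩ are those of M using x once, at a point
-- of N), and every closed test normalises to 0 or ε because linear substitution never
-- duplicates, so head reduction strictly decreases the size of every summand.
--
-- Soundness then follows from compositionality: inclusion of interpretations is preserved by
-- contexts and by the partial injective renamings that close M and N.
-- Completeness uses definability: every point γ of 𝒟 is the only point of a closed
-- "characteristic" term, whose abstractions test their argument against characteristic bags.
-- Closing M by λx⃗ and applying it to the characteristic bags of the point coding (a⃗, α)
-- gives a test that converges iff (a⃗, α) ∈ ⟦M⟧.

module Submission where

open import Defs
open import Data.Nat using (ℕ; zero; suc; _+_; _≤_; _<_; s≤s)
open import Data.Nat.Properties
  using ( +-assoc; +-suc; +-identityʳ; ≤-refl; ≤-trans; ≤-reflexive; +-monoˡ-≤; +-monoʳ-≤; n≤1+n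
        ; +-commutativeSemigroup; module ≤-Reasoning)
open import Algebra.Properties.CommutativeSemigroup +-commutativeSemigroup using (xy∙z≈xz∙y)
open import Data.Nat.Induction using (<-wellFounded)
open import Induction.WellFounded using (Acc; acc)
open import Data.Fin using (Fin; zero; suc; _≟_)
open import Data.Fin.Properties using (any?; suc-injective)
open import Data.Maybe using (Maybe; just; nothing) renaming (map to mapMaybe′)
open import Data.Maybe.Properties using (≡-dec; just-injective)
open import Data.List using (List; []; _∷_; _++_; length; map; mapMaybe; concatMap)
open import Data.List.Properties using (++-assoc; length-++; ++-identityʳ; ∷-injective)
open import Data.List.Membership.Propositional using (_∈_; lose) renaming (find to find∈)
open import Data.List.Membership.Propositional.Properties
  using (∈-map⁺; ∈-map⁻; ∈-++⁺ˡ; ∈-++⁺ʳ; ∈-++⁻; ∈-concatMap⁺; ∈-concatMap⁻)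
open import Data.List.Relation.Unary.Any using (Any; here; there)
import Data.List.Relation.Unary.Any as Any
import Data.List.Relation.Unary.Any.Properties as Any
open import Data.List.Relation.Unary.All using (All; []; _∷_)
import Data.List.Relation.Unary.All as All
open import Data.Vec using ([]; _∷_; lookup; tabulate)
open import Data.Vec.Properties using (lookup-zipWith; lookup-replicate; lookup∘tabulate)
open import Data.Product using (Σ; ∃; _×_; _,_; proj₁; proj₂)
open import Data.Sum using (_⊎_; inj₁; inj₂)
open import Data.Empty using (⊥-elim)
open import Data.Bool using (true; false; if_then_else_)
open import Function.Bundles using (_⇔_; mk⇔)
open import Relation.Nullary using (yes; no; does; ¬_; Dec)
open import Relation.Binary.PropositionalEquality
  using (_≡_; _≢_; refl; sym; cong; cong₂; subst; subst₂; module ≡-Reasoning) renaming (trans to ≡-trans)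
open import Data.List.Relation.Binary.Permutation.Propositional using (_↭_; ↭-sym; ↭-refl)
import Data.List.Relation.Binary.Permutation.Propositional.Properties as ↭
open import Relation.Binary.Construct.Closure.ReflexiveTransitive
  using (_◅_; _◅◅_) renaming (ε to ε*)

-- Finite multisets and the elements of 𝒟

≈M-length : ∀ {a b} → a ≈M b → length a ≡ length b
≈M-length []          = refl
≈M-length (_ ∷ p)     = cong suc (≈M-length p)
≈M-length swap        = refl
≈M-length (trans p q) = ≡-trans (≈M-length p) (≈M-length q)

≈M[]⇒≡[] : ∀ {a} → a ≈M [] → a ≡ []
≈M[]⇒≡[] {[]}    _ = refl
≈M[]⇒≡[] {_ ∷ _} p with ≈M-length p
... | ()

[]≈M⇒≡[] : ∀ {a} → [] ≈M a → a ≡ []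
[]≈M⇒≡[] {[]}    _ = refl
[]≈M⇒≡[] {_ ∷ _} p with ≈M-length p
... | ()

∷≉M[] : ∀ {α a} → ¬ ((α ∷ a) ≈M [])
∷≉M[] p with ≈M[]⇒≡[] p
... | ()

mutual
  ≈D-refl : ∀ α → α ≈D α
  ≈D-refl (seq s) = seq (≈Sq-refl s)

  ≈Sq-refl : ∀ s → s ≈Sq s
  ≈Sq-refl []      = []
  ≈Sq-refl (a ∷ s) = ≈M-refl a ∷ ≈Sq-refl s

  ≈M-refl : ∀ a → a ≈M a
  ≈M-refl []      = []
  ≈M-refl (α ∷ a) = ≈D-refl α ∷ ≈M-refl a

mutual
  ≈D-sym : ∀ {α β} → α ≈D β → β ≈D α
  ≈D-sym (seq p) = seq (≈Sq-sym p)

  ≈Sq-sym : ∀ {s t} → s ≈Sq t → t ≈Sq s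
  ≈Sq-sym []       = []
  ≈Sq-sym (p ∷ q)  = ≈M-sym p ∷ ≈Sq-sym q
  ≈Sq-sym (padL p) = padR (≈Sq-sym p)
  ≈Sq-sym (padR p) = padL (≈Sq-sym p)

  ≈M-sym : ∀ {a b} → a ≈M b → b ≈M a
  ≈M-sym []          = []
  ≈M-sym (p ∷ q)     = ≈D-sym p ∷ ≈M-sym q
  ≈M-sym swap        = swap
  ≈M-sym (trans p q) = trans (≈M-sym q) (≈M-sym p)

≡⇒≈M : ∀ {a b} → a ≡ b → a ≈M b
≡⇒≈M {a} refl = ≈M-refl a

-- padL and padR only apply to a syntactically empty head; these accept any empty multiset.
padL≈ : ∀ {a s} → a ≈M [] → s ≈Sq [] → (a ∷ s) ≈Sq []
padL≈ p q with ≈M[]⇒≡[] p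
... | refl = padL q

padR≈ : ∀ {a t} → [] ≈M a → [] ≈Sq t → [] ≈Sq (a ∷ t)
padR≈ p q with []≈M⇒≡[] p
... | refl = padR q

≈Sq-trans : ∀ {s t u} → s ≈Sq t → t ≈Sq u → s ≈Sq u
≈Sq-trans []       q         = q
≈Sq-trans (p ∷ p') (q ∷ q')  = trans p q ∷ ≈Sq-trans p' q'
≈Sq-trans (p ∷ p') (padL q)  = padL≈ p (≈Sq-trans p' q)
≈Sq-trans (padL p) []        = padL p
≈Sq-trans (padL p) (padR q)  = [] ∷ ≈Sq-trans p q
≈Sq-trans (padR p) (q ∷ q')  = padR≈ q (≈Sq-trans p q')
≈Sq-trans (padR p) (padL q)  = []

≈D-trans : ∀ {α β γ} → α ≈D β → β ≈D γ → α ≈D γ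
≈D-trans (seq p) (seq q) = seq (≈Sq-trans p q)

≈M-++ˡ : ∀ {a a'} → a ≈M a' → ∀ b → (a ++ b) ≈M (a' ++ b)
≈M-++ˡ []          b = ≈M-refl b
≈M-++ˡ (p ∷ p')    b = p ∷ ≈M-++ˡ p' b
≈M-++ˡ swap        b = swap
≈M-++ˡ (trans p q) b = trans (≈M-++ˡ p b) (≈M-++ˡ q b)

≈M-++ʳ : ∀ a {b b'} → b ≈M b' → (a ++ b) ≈M (a ++ b')
≈M-++ʳ []      q = q
≈M-++ʳ (α ∷ a) q = ≈D-refl α ∷ ≈M-++ʳ a q

≈M-++ : ∀ {a a' b b'} → a ≈M a' → b ≈M b' → (a ++ b) ≈M (a' ++ b')
≈M-++ {a' = a'} {b} p q = trans (≈M-++ˡ p b) (≈M-++ʳ a' q)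

≈M-middle : ∀ a β b → (a ++ β ∷ b) ≈M (β ∷ a ++ b)
≈M-middle []      β b = ≈M-refl (β ∷ b)
≈M-middle (α ∷ a) β b = trans (≈D-refl α ∷ ≈M-middle a β b) swap

≈M-++-comm : ∀ a b → (a ++ b) ≈M (b ++ a)
≈M-++-comm []      b = ≡⇒≈M (sym (++-identityʳ b))
≈M-++-comm (α ∷ a) b = trans (≈D-refl α ∷ ≈M-++-comm a b) (≈M-sym (≈M-middle b α a))

≈M-++-identityʳ : ∀ a → (a ++ []) ≈M a
≈M-++-identityʳ a = ≡⇒≈M (++-identityʳ a)

++≈M[]⇒ˡ : ∀ {a b} → (a ++ b) ≈M [] → a ≡ []
++≈M[]⇒ˡ {[]}    _ = refl
++≈M[]⇒ˡ {_ ∷ _} p = ⊥-elim (∷≉M[] p)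

++≈M[]⇒ʳ : ∀ {a b} → (a ++ b) ≈M [] → b ≡ []
++≈M[]⇒ʳ {[]}    p = ≈M[]⇒≡[] p
++≈M[]⇒ʳ {_ ∷ _} p = ⊥-elim (∷≉M[] p)

≈M-singleton⁻ : ∀ {α β} → (α ∷ []) ≈M (β ∷ []) → α ≈D β
≈M-singleton⁻ (p ∷ _) = p
≈M-singleton⁻ (trans {b = []} p q) = ⊥-elim (∷≉M[] p)
≈M-singleton⁻ (trans {b = _ ∷ []} p q) = ≈D-trans (≈M-singleton⁻ p) (≈M-singleton⁻ q)
≈M-singleton⁻ (trans {b = _ ∷ _ ∷ _} p q) with ≈M-length p
... | ()

≈M-snoc-singleton⁻ : ∀ {a β α} → (a ++ β ∷ []) ≈M (α ∷ []) → a ≡ [] × β ≈D α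
≈M-snoc-singleton⁻ {[]} p = refl , ≈M-singleton⁻ p
≈M-snoc-singleton⁻ {x ∷ a} {β} p with ≡-trans (sym (≈M-length p)) (length-++ (x ∷ a) {β ∷ []})
≈M-snoc-singleton⁻ {_ ∷ []}    p | ()
≈M-snoc-singleton⁻ {_ ∷ _ ∷ _} p | ()

∷D-cong : ∀ {a b α β} → a ≈M b → α ≈D β → (a ∷D α) ≈D (b ∷D β)
∷D-cong {α = seq s} {seq t} p (seq q) = seq (p ∷ q)

∷D-injective : ∀ {a b α β} → (a ∷D α) ≈D (b ∷D β) → a ≈M b × α ≈D β
∷D-injective {α = seq s} {seq t} (seq (p ∷ q)) = p , seq q

⋆≈[]∷D⋆ : ⋆ ≈D ([] ∷D ⋆)
⋆≈[]∷D⋆ = seq (padR [])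

∷D≈⋆⁻ : ∀ {a α} → (a ∷D α) ≈D ⋆ → a ≈M [] × α ≈D ⋆
∷D≈⋆⁻ {α = seq s} (seq (padL p)) = [] , seq p

≈M-locate : ∀ {x d} → x ≈M d → ∀ e₁ γ e₂ → x ≡ e₁ ++ γ ∷ e₂ →
  Σ (List 𝒟) λ d₁ → Σ (List 𝒟) λ d₂ → Σ 𝒟 λ γ' →
    d ≡ d₁ ++ γ' ∷ d₂ × γ ≈D γ' × (e₁ ++ e₂) ≈M (d₁ ++ d₂)
≈M-locate (_∷_ {β = β} {b = b} p q) [] γ e₂ refl = [] , b , β , refl , p , q
≈M-locate (_∷_ {β = β} p q) (_ ∷ e₁) γ e₂ refl with ≈M-locate q e₁ γ e₂ refl
... | d₁ , d₂ , γ' , eq , g , r = β ∷ d₁ , d₂ , γ' , cong (β ∷_) eq , g , p ∷ r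
≈M-locate (swap {α} {β} {a}) []          γ e₂ refl = β ∷ [] , a , α , refl , ≈D-refl α , ≈M-refl (β ∷ a)
≈M-locate (swap {α} {β} {a}) (_ ∷ [])    γ e₂ refl = [] , α ∷ a , β , refl , ≈D-refl β , ≈M-refl (α ∷ a)
≈M-locate (swap {α} {β})     (_ ∷ _ ∷ e₁) γ e₂ refl = β ∷ α ∷ e₁ , e₂ , γ , refl , ≈D-refl γ , swap
≈M-locate (trans p q) e₁ γ e₂ eq with ≈M-locate p e₁ γ e₂ eq
... | f₁ , f₂ , γ″ , eq₁ , g₁ , r₁ with ≈M-locate q f₁ γ″ f₂ eq₁
... | d₁ , d₂ , γ' , eq₂ , g₂ , r₂ = d₁ , d₂ , γ' , eq₂ , ≈D-trans g₁ g₂ , trans r₁ r₂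

++≡++∷-split : ∀ {A : Set} (a b d₁ : List A) γ d₂ → a ++ b ≡ d₁ ++ γ ∷ d₂ →
  (Σ (List A) λ a' → a ≡ d₁ ++ γ ∷ a' × d₂ ≡ a' ++ b) ⊎
  (Σ (List A) λ b₁ → b ≡ b₁ ++ γ ∷ d₂ × d₁ ≡ a ++ b₁)
++≡++∷-split []      b d₁       γ d₂ eq   = inj₂ (d₁ , eq , refl)
++≡++∷-split (x ∷ a) b []       γ d₂ refl = inj₁ (a , refl , refl)
++≡++∷-split (x ∷ a) b (y ∷ d₁) γ d₂ eq with ∷-injective eq
... | refl , eq' with ++≡++∷-split a b d₁ γ d₂ eq'
... | inj₁ (a' , e₁ , e₂) = inj₁ (a' , cong (x ∷_) e₁ , e₂)
... | inj₂ (b₁ , e₁ , e₂) = inj₂ (b₁ , e₁ , cong (x ∷_) e₂)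

∷≈M++⁻ : ∀ {β c} a b → (β ∷ c) ≈M (a ++ b) →
  (Σ (List 𝒟) λ a' → a ≈M (β ∷ a') × c ≈M (a' ++ b)) ⊎
  (Σ (List 𝒟) λ b' → b ≈M (β ∷ b') × c ≈M (a ++ b'))
∷≈M++⁻ {β} {c} a b p with ≈M-locate p [] β c refl
... | d₁ , d₂ , γ , eq , g , r with ++≡++∷-split a b d₁ γ d₂ eq
... | inj₁ (a' , refl , refl) =
      inj₁ (d₁ ++ a' , trans (≈M-middle d₁ γ a') (≈D-sym g ∷ ≈M-refl _) ,
            trans r (≈M-sym (≡⇒≈M (++-assoc d₁ a' b))))
... | inj₂ (b₁ , refl , refl) =
      inj₂ (b₁ ++ d₂ , trans (≈M-middle b₁ γ d₂) (≈D-sym g ∷ ≈M-refl _) ,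
            trans r (≡⇒≈M (++-assoc a b₁ d₂)))

-- Environments

-- A record rather than the bare function type _≈E_, so that the two environments can be inferred.
record _≋_ {n : ℕ} (as bs : Env n) : Set where
  constructor mk
  field un : as ≈E bs
open _≋_ public

≋-refl : ∀ {n} (as : Env n) → as ≋ as
≋-refl as = mk λ i → ≈M-refl (lookup as i)

≈E-refl : ∀ {n} (as : Env n) → as ≈E as
≈E-refl as = un (≋-refl as)

≋-sym : ∀ {n} {as bs : Env n} → as ≋ bs → bs ≋ as
≋-sym (mk p) = mk λ i → ≈M-sym (p i)

≋-trans : ∀ {n} {as bs cs : Env n} → as ≋ bs → bs ≋ cs → as ≋ cs
≋-trans (mk p) (mk q) = mk λ i → trans (p i) (q i)

∷-≋ : ∀ {n} {a b} {as bs : Env n} → a ≈M b → as ≋ bs → (a ∷ as) ≋ (b ∷ bs)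
∷-≋ p (mk q) = mk λ { zero → p ; (suc i) → q i }

≋-head : ∀ {n} {a b} {as bs : Env n} → (a ∷ as) ≋ (b ∷ bs) → a ≈M b
≋-head (mk p) = p zero

≋-tail : ∀ {n} {a b} {as bs : Env n} → (a ∷ as) ≋ (b ∷ bs) → as ≋ bs
≋-tail (mk p) = mk λ i → p (suc i)

lookup-⊎E : ∀ {n} (as bs : Env n) i → lookup (as ⊎E bs) i ≡ lookup as i ++ lookup bs i
lookup-⊎E as bs i = lookup-zipWith _++_ i as bs

lookup-emptyE : ∀ {n} (i : Fin n) → lookup (emptyE {n}) i ≡ []
lookup-emptyE i = lookup-replicate i []

lookup-singleE : ∀ {n} (i j : Fin n) α →
  lookup (singleE i α) j ≡ (if does (i ≟ j) then α ∷ [] else [])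
lookup-singleE i j α = lookup∘tabulate _ j

lookup-singleE-≡ : ∀ {n} (i : Fin n) α → lookup (singleE i α) i ≡ α ∷ []
lookup-singleE-≡ i α rewrite lookup-singleE i i α with i ≟ i
... | yes _ = refl
... | no ne = ⊥-elim (ne refl)

lookup-singleE-≢ : ∀ {n} {i j : Fin n} α → i ≢ j → lookup (singleE i α) j ≡ []
lookup-singleE-≢ {i = i} {j} α ne rewrite lookup-singleE i j α with i ≟ j
... | yes e = ⊥-elim (ne e)
... | no _  = refl

⊎E-cong : ∀ {n} {as as' bs bs' : Env n} → as ≋ as' → bs ≋ bs' → (as ⊎E bs) ≋ (as' ⊎E bs')
⊎E-cong {as = as} {as'} {bs} {bs'} (mk p) (mk q) = mk λ i →
  subst₂ _≈M_ (sym (lookup-⊎E as bs i)) (sym (lookup-⊎E as' bs' i)) (≈M-++ (p i) (q i))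

⊎E-comm : ∀ {n} (as bs : Env n) → (as ⊎E bs) ≋ (bs ⊎E as)
⊎E-comm as bs = mk λ i →
  subst₂ _≈M_ (sym (lookup-⊎E as bs i)) (sym (lookup-⊎E bs as i))
    (≈M-++-comm (lookup as i) (lookup bs i))

⊎E-assoc : ∀ {n} (as bs cs : Env n) → ((as ⊎E bs) ⊎E cs) ≋ (as ⊎E (bs ⊎E cs))
⊎E-assoc as bs cs = mk λ i → ≡⇒≈M (begin
  lookup ((as ⊎E bs) ⊎E cs) i                  ≡⟨ lookup-⊎E (as ⊎E bs) cs i ⟩
  lookup (as ⊎E bs) i ++ lookup cs i           ≡⟨ cong (_++ lookup cs i) (lookup-⊎E as bs i) ⟩
  (lookup as i ++ lookup bs i) ++ lookup cs i  ≡⟨ ++-assoc (lookup as i) _ _ ⟩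
  lookup as i ++ (lookup bs i ++ lookup cs i)  ≡⟨ cong (lookup as i ++_) (lookup-⊎E bs cs i) ⟨
  lookup as i ++ lookup (bs ⊎E cs) i           ≡⟨ lookup-⊎E as (bs ⊎E cs) i ⟨
  lookup (as ⊎E (bs ⊎E cs)) i                  ∎)
  where open ≡-Reasoning

⊎E-identityˡ : ∀ {n} (as : Env n) → (emptyE ⊎E as) ≋ as
⊎E-identityˡ as = mk λ i →
  subst (_≈M lookup as i) (sym (≡-trans (lookup-⊎E emptyE as i) (cong (_++ lookup as i) (lookup-emptyE i))))
    (≈M-refl (lookup as i))

⊎E-identityʳ : ∀ {n} (as : Env n) → (as ⊎E emptyE) ≋ as
⊎E-identityʳ as = ≋-trans (⊎E-comm as emptyE) (⊎E-identityˡ as)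

⊎E-rotate : ∀ {n} (a b c : Env n) → ((a ⊎E b) ⊎E c) ≋ ((a ⊎E c) ⊎E b)
⊎E-rotate a b c =
  ≋-trans (⊎E-assoc a b c) (≋-trans (⊎E-cong (≋-refl a) (⊎E-comm b c)) (≋-sym (⊎E-assoc a c b)))

⊎E-exchange : ∀ {n} {as e₁ e₂ f₁ f₂ : Env n} →
  as ≋ (e₁ ⊎E e₂) → e₂ ≋ (f₁ ⊎E f₂) → as ≋ (f₁ ⊎E (e₁ ⊎E f₂))
⊎E-exchange {e₁ = e₁} {f₁ = f₁} {f₂} p q =
  ≋-trans p (≋-trans (⊎E-cong (≋-refl e₁) q) (≋-trans (≋-sym (⊎E-assoc e₁ f₁ f₂))
    (≋-trans (⊎E-cong (⊎E-comm e₁ f₁) (≋-refl f₂)) (⊎E-assoc f₁ e₁ f₂))))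

⊎E-absorbʳ : ∀ {n} {e e₁ e₂ : Env n} → e ≋ (e₁ ⊎E e₂) → e₂ ≋ emptyE → e ≋ e₁
⊎E-absorbʳ {e₁ = e₁} q p = ≋-trans q (≋-trans (⊎E-cong (≋-refl e₁) p) (⊎E-identityʳ e₁))

emptyE≋emptyE⊎emptyE : ∀ {n} → emptyE {n} ≋ (emptyE ⊎E emptyE)
emptyE≋emptyE⊎emptyE = ≋-sym (⊎E-identityˡ emptyE)

Env0-≋ : ∀ (as bs : Env 0) → as ≋ bs
Env0-≋ [] [] = mk λ ()

singleE-cong : ∀ {n} (i : Fin n) {α α'} → α ≈D α' → singleE i α ≋ singleE i α'
singleE-cong i {α} {α'} d = mk λ j →
  subst₂ _≈M_ (sym (lookup-singleE i j α)) (sym (lookup-singleE i j α')) (at (does (i ≟ j)))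
  where
  at : ∀ b → (if b then α ∷ [] else []) ≈M (if b then α' ∷ [] else [])
  at true  = d ∷ []
  at false = []

singleE-suc : ∀ {n} (x : Fin n) β → singleE (suc x) β ≋ ([] ∷ singleE x β)
singleE-suc x β = mk at
  where
  at : ∀ j → lookup (singleE (suc x) β) j ≈M lookup ([] ∷ singleE x β) j
  at zero rewrite lookup-singleE-≢ {i = suc x} {zero} β (λ ()) = []
  at (suc j) with x ≟ j
  ... | yes refl rewrite lookup-singleE-≡ (suc x) β = ≈M-refl _
  ... | no ne rewrite lookup-singleE-≢ {i = suc x} {suc j} β (λ e → ne (suc-injective e)) = []

singleE-zero : ∀ {n} β → singleE {suc n} zero β ≋ ((β ∷ []) ∷ emptyE)
singleE-zero {n} β = mk at
  where
  at : ∀ j → lookup (singleE zero β) j ≈M lookup ((β ∷ []) ∷ emptyE) j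
  at zero rewrite lookup-singleE-≡ (zero {n}) β = ≈M-refl (β ∷ [])
  at (suc j) rewrite lookup-singleE-≢ {i = zero} {suc j} β (λ ()) | lookup-emptyE j = []

setE : ∀ {n} → Env n → Fin n → List 𝒟 → Env n
setE (a ∷ as) zero    c = c ∷ as
setE (a ∷ as) (suc i) c = a ∷ setE as i c

lookup-setE-≡ : ∀ {n} (as : Env n) i c → lookup (setE as i c) i ≡ c
lookup-setE-≡ (a ∷ as) zero    c = refl
lookup-setE-≡ (a ∷ as) (suc i) c = lookup-setE-≡ as i c

lookup-setE-≢ : ∀ {n} (as : Env n) {i j} c → i ≢ j → lookup (setE as i c) j ≡ lookup as j
lookup-setE-≢ (a ∷ as) {zero}  {zero}  c ne = ⊥-elim (ne refl)
lookup-setE-≢ (a ∷ as) {zero}  {suc j} c ne = refl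
lookup-setE-≢ (a ∷ as) {suc i} {zero}  c ne = refl
lookup-setE-≢ (a ∷ as) {suc i} {suc j} c ne = lookup-setE-≢ as c (λ e → ne (cong suc e))

≋-split-at : ∀ {n} (x : Fin n) {as bs : Env n} →
  (∀ j → x ≡ j → lookup as j ≈M lookup bs j) → (∀ j → x ≢ j → lookup as j ≈M lookup bs j) → as ≋ bs
≋-split-at x {as} {bs} h≡ h≢ = mk λ j → at j (x ≟ j)
  where
  at : ∀ j → Dec (x ≡ j) → lookup as j ≈M lookup bs j
  at j (yes e) = h≡ j e
  at j (no ne) = h≢ j ne

lookup-⊎E-singleE-≡ : ∀ {n} (as : Env n) x β → lookup (as ⊎E singleE x β) x ≡ lookup as x ++ β ∷ []
lookup-⊎E-singleE-≡ as x β rewrite lookup-⊎E as (singleE x β) x | lookup-singleE-≡ x β = refl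

lookup-⊎E-singleE-≢ : ∀ {n} (as : Env n) {x j} β → x ≢ j →
  lookup (as ⊎E singleE x β) j ≡ lookup as j ++ []
lookup-⊎E-singleE-≢ as {x} {j} β ne rewrite lookup-⊎E as (singleE x β) j | lookup-singleE-≢ β ne = refl

≋-setE-⊎E-singleE : ∀ {n} (e : Env n) x {β a'} → lookup e x ≈M (β ∷ a') →
  e ≋ (setE e x a' ⊎E singleE x β)
≋-setE-⊎E-singleE e x {β} {a'} p = ≋-split-at x at≡ at≢
  where
  at≡ : ∀ j → x ≡ j → lookup e j ≈M lookup (setE e x a' ⊎E singleE x β) j
  at≡ j refl rewrite lookup-⊎E-singleE-≡ (setE e x a') x β | lookup-setE-≡ e x a' =
    trans p (≈M-++-comm (β ∷ []) a')
  at≢ : ∀ j → x ≢ j → lookup e j ≈M lookup (setE e x a' ⊎E singleE x β) j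
  at≢ j ne rewrite lookup-⊎E-singleE-≢ (setE e x a') β ne | lookup-setE-≢ e a' ne =
    ≈M-sym (≈M-++-identityʳ _)

⊎E-singleE-locateˡ : ∀ {n} (x : Fin n) {β a'} {as₁ e₁ e₂ : Env n} → (as₁ ⊎E singleE x β) ≋ (e₁ ⊎E e₂) →
  lookup e₁ x ≈M (β ∷ a') → lookup as₁ x ≈M (a' ++ lookup e₂ x) →
  e₁ ≋ (setE e₁ x a' ⊎E singleE x β) × as₁ ≋ (setE e₁ x a' ⊎E e₂)
⊎E-singleE-locateˡ x {β} {a'} {as₁} {e₁} {e₂} (mk q) p r =
  ≋-setE-⊎E-singleE e₁ x p , ≋-split-at x at≡ at≢
  where
  at≡ : ∀ j → x ≡ j → lookup as₁ j ≈M lookup (setE e₁ x a' ⊎E e₂) j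
  at≡ j refl rewrite lookup-⊎E (setE e₁ x a') e₂ x | lookup-setE-≡ e₁ x a' = r
  at≢ : ∀ j → x ≢ j → lookup as₁ j ≈M lookup (setE e₁ x a' ⊎E e₂) j
  at≢ j ne rewrite lookup-⊎E (setE e₁ x a') e₂ j | lookup-setE-≢ e₁ a' ne =
    trans (≈M-sym (≈M-++-identityʳ _))
      (subst₂ _≈M_ (lookup-⊎E-singleE-≢ as₁ β ne) (lookup-⊎E e₁ e₂ j) (q j))

⊎E-singleE-locate : ∀ {n} (x : Fin n) β (as₁ e₁ e₂ : Env n) → (as₁ ⊎E singleE x β) ≋ (e₁ ⊎E e₂) →
  (Σ (Env n) λ e₁' → e₁ ≋ (e₁' ⊎E singleE x β) × as₁ ≋ (e₁' ⊎E e₂)) ⊎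
  (Σ (Env n) λ e₂' → e₂ ≋ (e₂' ⊎E singleE x β) × as₁ ≋ (e₁ ⊎E e₂'))
⊎E-singleE-locate x β as₁ e₁ e₂ (mk q) with ∷≈M++⁻ (lookup e₁ x) (lookup e₂ x) atx
  where
  atx : (β ∷ lookup as₁ x) ≈M (lookup e₁ x ++ lookup e₂ x)
  atx = trans (≈M-++-comm (β ∷ []) (lookup as₁ x))
          (subst₂ _≈M_ (lookup-⊎E-singleE-≡ as₁ x β) (lookup-⊎E e₁ e₂ x) (q x))
... | inj₁ (a' , p , r) = inj₁ (setE e₁ x a' , ⊎E-singleE-locateˡ x (mk q) p r)
... | inj₂ (b' , p , r) with ⊎E-singleE-locateˡ x (≋-trans (mk q) (⊎E-comm e₁ e₂)) p
                               (trans r (≈M-++-comm (lookup e₁ x) b'))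
...   | e₂≋ , as₁≋ = inj₂ (setE e₂ x b' , e₂≋ , ≋-trans as₁≋ (⊎E-comm _ e₁))

⊎E-singleE≉emptyE : ∀ {n} (x : Fin n) β (as₁ : Env n) → ¬ ((as₁ ⊎E singleE x β) ≋ emptyE)
⊎E-singleE≉emptyE x β as₁ (mk q)
  with ++≈M[]⇒ʳ {lookup as₁ x} (subst₂ _≈M_ (lookup-⊎E-singleE-≡ as₁ x β) (lookup-emptyE x) (q x))
... | ()

⊎E-singleE≋singleE⁻ : ∀ {n} (x : Fin n) {β α} (as₁ : Env n) →
  (as₁ ⊎E singleE x β) ≋ singleE x α → as₁ ≋ emptyE × β ≈D α
⊎E-singleE≋singleE⁻ x {β} {α} as₁ (mk q) = ≋-split-at x at≡ at≢ , proj₂ atx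
  where
  atx : lookup as₁ x ≡ [] × β ≈D α
  atx = ≈M-snoc-singleton⁻
          (subst₂ _≈M_ (lookup-⊎E-singleE-≡ as₁ x β) (lookup-singleE-≡ x α) (q x))
  at≡ : ∀ j → x ≡ j → lookup as₁ j ≈M lookup emptyE j
  at≡ j refl rewrite lookup-emptyE x | proj₁ atx = []
  at≢ : ∀ j → x ≢ j → lookup as₁ j ≈M lookup emptyE j
  at≢ j ne rewrite lookup-emptyE j
    | ++≈M[]⇒ˡ {lookup as₁ j} {[]}
        (subst₂ _≈M_ (lookup-⊎E-singleE-≢ as₁ β ne) (lookup-singleE-≢ α ne) (q j)) = []

⊎E-singleE≉singleE : ∀ {n} {x y : Fin n} {β α} (as₁ : Env n) → x ≢ y →
  ¬ ((as₁ ⊎E singleE x β) ≋ singleE y α)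
⊎E-singleE≉singleE {x = x} {y} {β} {α} as₁ ne (mk q)
  with ++≈M[]⇒ʳ {lookup as₁ x}
         (subst₂ _≈M_ (lookup-⊎E-singleE-≡ as₁ x β) (lookup-singleE-≢ α (λ e → ne (sym e))) (q x))
... | ()

-- Basic properties of the interpretation

mutual
  ⟦⟧-resp : ∀ {n} (M : Term n) {as as' α α'} → ⟦ M ⟧ as α → as ≋ as' → α ≈D α' → ⟦ M ⟧ as' α'
  ⟦⟧-resp (var i) {as} p e d = un (≋-trans (≋-sym e) (≋-trans (mk {as = as} p) (singleE-cong i d)))
  ⟦⟧-resp (lam M) (b , α , q , h) e d =
    b , α , ≈D-trans (≈D-sym d) q , ⟦⟧-resp M h (∷-≋ (≈M-refl b) e) (≈D-refl α)
  ⟦⟧-resp (app M P) (as₁ , as₂ , b , q , h₁ , h₂) e d =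
    as₁ , as₂ , b , un (≋-trans (≋-sym e) (mk {bs = as₁ ⊎E as₂} q)) ,
    ⟦⟧-resp M h₁ (≋-refl as₁) (∷D-cong (≈M-refl b) d) , h₂
  ⟦⟧-resp (tbar V) (q , h) e d = ≈D-trans (≈D-sym d) q , ⟦⟧v-resp V h e

  ⟦⟧b-resp : ∀ {n} (P : Bag n) {as as' b b'} → ⟦ P ⟧b as b → as ≋ as' → b ≈M b' → ⟦ P ⟧b as' b'
  ⟦⟧b-resp []      (q , r) e d = un (≋-trans (≋-sym e) (mk {bs = emptyE} q)) , trans (≈M-sym d) r
  ⟦⟧b-resp (L ∷ P) (as₁ , as₂ , β , b″ , q , h₁ , h₂ , r) e d =
    as₁ , as₂ , β , b″ , un (≋-trans (≋-sym e) (mk {bs = as₁ ⊎E as₂} q)) , h₁ , h₂ , trans (≈M-sym d) r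

  ⟦⟧v-resp : ∀ {n} (V : Test n) {as as'} → ⟦ V ⟧v as → as ≋ as' → ⟦ V ⟧v as'
  ⟦⟧v-resp []      q e = un (≋-trans (≋-sym e) (mk {bs = emptyE} q))
  ⟦⟧v-resp (L ∷ V) (as₁ , as₂ , q , h₁ , h₂) e = as₁ , as₂ , un (≋-trans (≋-sym e) (mk {bs = as₁ ⊎E as₂} q)) , h₁ , h₂

⟦⟧-respᴱ : ∀ {n} (M : Term n) {as as' α} → ⟦ M ⟧ as α → as ≋ as' → ⟦ M ⟧ as' α
⟦⟧-respᴱ M h e = ⟦⟧-resp M h e (≈D-refl _)

⟦⟧b-swap : ∀ {n} {L L' : Term n} {P as b} → ⟦ L ∷ L' ∷ P ⟧b as b → ⟦ L' ∷ L ∷ P ⟧b as b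
⟦⟧b-swap {as = as} (e₁ , e₂ , β , b' , q , hL , (f₁ , f₂ , β' , b″ , q' , hL' , hP , r') , r) =
  f₁ , (e₁ ⊎E f₂) , β' , (β ∷ b″) , un (⊎E-exchange (mk {as = as} {e₁ ⊎E e₂} q) (mk {as = e₂} {f₁ ⊎E f₂} q')) , hL' ,
  (e₁ , f₂ , β , b″ , ≈E-refl (e₁ ⊎E f₂) , hL , hP , ≈M-refl _) , trans r (trans (≈D-refl β ∷ r') swap)

⟦⟧v-swap : ∀ {n} {L L' : Term n} {V as} → ⟦ L ∷ L' ∷ V ⟧v as → ⟦ L' ∷ L ∷ V ⟧v as
⟦⟧v-swap {as = as} (e₁ , e₂ , q , hL , (f₁ , f₂ , q' , hL' , hV)) =
  f₁ , (e₁ ⊎E f₂) , un (⊎E-exchange (mk {as = as} {e₁ ⊎E e₂} q) (mk {as = e₂} {f₁ ⊎E f₂} q')) , hL' ,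
  (e₁ , f₂ , ≈E-refl (e₁ ⊎E f₂) , hL , hV)

mutual
  ≈T⇒⟦⟧⊆ : ∀ {n} {M M' : Term n} → M ≈T M' → ∀ {as α} → ⟦ M ⟧ as α → ⟦ M' ⟧ as α
  ≈T⇒⟦⟧⊆ (var i)   h = h
  ≈T⇒⟦⟧⊆ (lam p)   (b , α , q , h) = b , α , q , ≈T⇒⟦⟧⊆ p h
  ≈T⇒⟦⟧⊆ (app p q) (as₁ , as₂ , b , r , h₁ , h₂) = as₁ , as₂ , b , r , ≈T⇒⟦⟧⊆ p h₁ , ≈L⇒⟦⟧b⊆ q h₂
  ≈T⇒⟦⟧⊆ (tbar q)  (r , h) = r , ≈L⇒⟦⟧v⊆ q h

  ≈L⇒⟦⟧b⊆ : ∀ {n} {P P' : Bag n} → P ≈L P' → ∀ {as b} → ⟦ P ⟧b as b → ⟦ P' ⟧b as b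
  ≈L⇒⟦⟧b⊆ []          h = h
  ≈L⇒⟦⟧b⊆ (p ∷ q)     (as₁ , as₂ , β , b' , r , h₁ , h₂ , s) = as₁ , as₂ , β , b' , r , ≈T⇒⟦⟧⊆ p h₁ , ≈L⇒⟦⟧b⊆ q h₂ , s
  ≈L⇒⟦⟧b⊆ swap        {as} h = ⟦⟧b-swap {as = as} h
  ≈L⇒⟦⟧b⊆ (trans p q) h = ≈L⇒⟦⟧b⊆ q (≈L⇒⟦⟧b⊆ p h)

  ≈L⇒⟦⟧v⊆ : ∀ {n} {V V' : Test n} → V ≈L V' → ∀ {as} → ⟦ V ⟧v as → ⟦ V' ⟧v as
  ≈L⇒⟦⟧v⊆ []          h = h
  ≈L⇒⟦⟧v⊆ (p ∷ q)     (as₁ , as₂ , r , h₁ , h₂) = as₁ , as₂ , r , ≈T⇒⟦⟧⊆ p h₁ , ≈L⇒⟦⟧v⊆ q h₂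
  ≈L⇒⟦⟧v⊆ swap        {as} h = ⟦⟧v-swap {as = as} h
  ≈L⇒⟦⟧v⊆ (trans p q) h = ≈L⇒⟦⟧v⊆ q (≈L⇒⟦⟧v⊆ p h)

mutual
  ≈T-refl : ∀ {n} (M : Term n) → M ≈T M
  ≈T-refl (var i)   = var i
  ≈T-refl (lam M)   = lam (≈T-refl M)
  ≈T-refl (app M P) = app (≈T-refl M) (≈L-refl P)
  ≈T-refl (tbar V)  = tbar (≈L-refl V)

  ≈L-refl : ∀ {n} (P : List (Term n)) → P ≈L P
  ≈L-refl []      = []
  ≈L-refl (L ∷ P) = ≈T-refl L ∷ ≈L-refl P

-- Partial renamings

record Transported {m k} (ρ : Fin m → Maybe (Fin k)) (as : Env m) (bs : Env k) : Set where
  field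
    at-image   : ∀ i j → ρ i ≡ just j → lookup as i ≈M lookup bs j
    off-domain : ∀ i → ρ i ≡ nothing → lookup as i ≈M []
    off-image  : ∀ j → (∀ i → ρ i ≢ just j) → lookup bs j ≈M []
open Transported

preimage? : ∀ {m k} (ρ : Fin m → Maybe (Fin k)) (j : Fin k) → Dec (∃ λ i → ρ i ≡ just j)
preimage? ρ j = any? (λ i → ≡-dec _≟_ (ρ i) (just j))

transportAt : ∀ {m k} (ρ : Fin m → Maybe (Fin k)) (as : Env m) (j : Fin k) → List 𝒟
transportAt ρ as j with preimage? ρ j
... | yes (i , _) = lookup as i
... | no _        = []

transport : ∀ {m k} (ρ : Fin m → Maybe (Fin k)) (as : Env m) → Env k
transport ρ as = tabulate (transportAt ρ as)

lookup-transport : ∀ {m k} (ρ : Fin m → Maybe (Fin k)) as j → lookup (transport ρ as) j ≡ transportAt ρ as j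
lookup-transport ρ as j = lookup∘tabulate _ j

module _ {m k : ℕ} {ρ : Fin m → Maybe (Fin k)} where

  transport-Transported : ∀ {as} → InjectiveWhereDefined ρ →
    (∀ i → ρ i ≡ nothing → lookup as i ≈M []) → Transported ρ as (transport ρ as)
  at-image (transport-Transported {as} inj h) i j e rewrite lookup-transport ρ as j with preimage? ρ j
  ... | yes (i' , e') rewrite inj i i' j e e' = ≈M-refl _
  ... | no ne = ⊥-elim (ne (i , e))
  off-domain (transport-Transported inj h) = h
  off-image (transport-Transported {as} inj h) j ne rewrite lookup-transport ρ as j with preimage? ρ j
  ... | yes (i , e) = ⊥-elim (ne i e)
  ... | no _ = []

  Transported⇒≋transport : ∀ {as bs} → Transported ρ as bs → bs ≋ transport ρ as
  Transported⇒≋transport {as} {bs} r = mk at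
    where
    at : ∀ j → lookup bs j ≈M lookup (transport ρ as) j
    at j rewrite lookup-transport ρ as j with preimage? ρ j
    ... | yes (i , e) = ≈M-sym (at-image r i j e)
    ... | no ne = off-image r j (λ i e → ne (i , e))

  transport-⊎E : ∀ as₁ as₂ → transport ρ (as₁ ⊎E as₂) ≋ (transport ρ as₁ ⊎E transport ρ as₂)
  transport-⊎E as₁ as₂ = mk at
    where
    at : ∀ j → lookup (transport ρ (as₁ ⊎E as₂)) j ≈M lookup (transport ρ as₁ ⊎E transport ρ as₂) j
    at j rewrite lookup-⊎E (transport ρ as₁) (transport ρ as₂) j | lookup-transport ρ (as₁ ⊎E as₂) j
               | lookup-transport ρ as₁ j | lookup-transport ρ as₂ j with preimage? ρ j
    ... | yes (i , e) rewrite lookup-⊎E as₁ as₂ i = ≈M-refl _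
    ... | no _ = []

  transport-cong : ∀ {as as'} → as ≋ as' → transport ρ as ≋ transport ρ as'
  transport-cong {as} {as'} (mk p) = mk at
    where
    at : ∀ j → lookup (transport ρ as) j ≈M lookup (transport ρ as') j
    at j rewrite lookup-transport ρ as j | lookup-transport ρ as' j with preimage? ρ j
    ... | yes (i , e) = p i
    ... | no _ = []

  transport-emptyE : transport ρ emptyE ≋ emptyE
  transport-emptyE = mk at
    where
    at : ∀ j → lookup (transport ρ emptyE) j ≈M lookup emptyE j
    at j rewrite lookup-transport ρ emptyE j | lookup-emptyE j with preimage? ρ j
    ... | yes (i , e) rewrite lookup-emptyE i = []
    ... | no _ = []

  Transported-⊎E : ∀ {as₁ as₂ bs₁ bs₂} → Transported ρ as₁ bs₁ → Transported ρ as₂ bs₂ →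
    Transported ρ (as₁ ⊎E as₂) (bs₁ ⊎E bs₂)
  at-image (Transported-⊎E {as₁} {as₂} {bs₁} {bs₂} p q) i j e rewrite lookup-⊎E as₁ as₂ i | lookup-⊎E bs₁ bs₂ j =
    ≈M-++ (at-image p i j e) (at-image q i j e)
  off-domain (Transported-⊎E {as₁} {as₂} p q) i e rewrite lookup-⊎E as₁ as₂ i =
    ≈M-++ (off-domain p i e) (off-domain q i e)
  off-image (Transported-⊎E {bs₁ = bs₁} {bs₂} p q) j ne rewrite lookup-⊎E bs₁ bs₂ j =
    ≈M-++ (off-image p j ne) (off-image q j ne)

  Transported-respʳ : ∀ {as bs bs'} → bs ≋ bs' → Transported ρ as bs → Transported ρ as bs'
  at-image (Transported-respʳ (mk p) r) i j e = trans (at-image r i j e) (p j)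
  off-domain (Transported-respʳ (mk p) r) = off-domain r
  off-image (Transported-respʳ (mk p) r) j ne = trans (≈M-sym (p j)) (off-image r j ne)

  Transported-emptyE : ∀ {bs} → bs ≋ emptyE → Transported ρ emptyE bs
  at-image (Transported-emptyE {bs} (mk p)) i j e rewrite lookup-emptyE i =
    ≈M-sym (subst (lookup bs j ≈M_) (lookup-emptyE j) (p j))
  off-domain (Transported-emptyE (mk p)) i e rewrite lookup-emptyE i = []
  off-image (Transported-emptyE {bs} (mk p)) j ne = subst (lookup bs j ≈M_) (lookup-emptyE j) (p j)

  Transported-emptyE⁻ : ∀ {as bs} → Transported ρ as bs → as ≋ emptyE → bs ≋ emptyE
  Transported-emptyE⁻ r p = ≋-trans (Transported⇒≋transport r) (≋-trans (transport-cong p) transport-emptyE)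

  Transported-split : ∀ {as bs as₁ as₂} → InjectiveWhereDefined ρ → Transported ρ as bs → as ≋ (as₁ ⊎E as₂) →
    Σ (Env k) λ bs₁ → Σ (Env k) λ bs₂ → bs ≋ (bs₁ ⊎E bs₂) × Transported ρ as₁ bs₁ × Transported ρ as₂ bs₂
  Transported-split {as} {bs} {as₁} {as₂} inj r (mk p) =
    transport ρ as₁ , transport ρ as₂ ,
    ≋-trans (Transported⇒≋transport r) (≋-trans (transport-cong (mk p)) (transport-⊎E as₁ as₂)) ,
    transport-Transported inj empty₁ , transport-Transported inj empty₂
    where
    empty₁₂ : ∀ i → ρ i ≡ nothing → (lookup as₁ i ++ lookup as₂ i) ≈M []
    empty₁₂ i e = subst (_≈M []) (lookup-⊎E as₁ as₂ i) (trans (≈M-sym (p i)) (off-domain r i e))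
    empty₁ : ∀ i → ρ i ≡ nothing → lookup as₁ i ≈M []
    empty₁ i e rewrite ++≈M[]⇒ˡ {lookup as₁ i} (empty₁₂ i e) = []
    empty₂ : ∀ i → ρ i ≡ nothing → lookup as₂ i ≈M []
    empty₂ i e rewrite ++≈M[]⇒ʳ {lookup as₁ i} {lookup as₂ i} (empty₁₂ i e) = []

  Transported-singleE : ∀ {i j bs α} → InjectiveWhereDefined ρ → ρ i ≡ just j → bs ≋ singleE j α →
    Transported ρ (singleE i α) bs
  at-image (Transported-singleE {i} {j} {bs} {α} inj e (mk p)) i' j' e' with i' ≟ i
  ... | yes refl rewrite just-injective (≡-trans (sym e') e) | lookup-singleE-≡ i α =
        ≈M-sym (subst (lookup bs j ≈M_) (lookup-singleE-≡ j α) (p j))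
  ... | no ne with j' ≟ j
  ...   | yes refl = ⊥-elim (ne (inj i' i j' e' e))
  ...   | no ne' rewrite lookup-singleE-≢ α (λ x → ne (sym x)) =
          ≈M-sym (subst (lookup bs j' ≈M_) (lookup-singleE-≢ α (λ x → ne' (sym x))) (p j'))
  off-domain (Transported-singleE {i} {α = α} inj e _) i' e' with i' ≟ i
  ... | yes refl with ≡-trans (sym e') e
  ...   | ()
  off-domain (Transported-singleE {i} {α = α} inj e _) i' e' | no ne
    rewrite lookup-singleE-≢ α (λ x → ne (sym x)) = []
  off-image (Transported-singleE {i} {j} {bs} {α} inj e (mk p)) j' ne with j' ≟ j
  ... | yes refl = ⊥-elim (ne i e)
  ... | no ne' = subst (lookup bs j' ≈M_) (lookup-singleE-≢ α (λ x → ne' (sym x))) (p j')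

  Transported-singleE⁻ : ∀ {i j as bs α} → InjectiveWhereDefined ρ → ρ i ≡ just j →
    Transported ρ as bs → as ≋ singleE i α → bs ≋ singleE j α
  Transported-singleE⁻ {i} {j} {as} {bs} {α} inj e r p =
    ≋-trans (Transported⇒≋transport r) (≋-trans (transport-cong p) (mk at))
    where
    at : ∀ j' → lookup (transport ρ (singleE i α)) j' ≈M lookup (singleE j α) j'
    at j' rewrite lookup-transport ρ (singleE i α) j' with preimage? ρ j'
    ... | yes (i' , e') with i' ≟ i
    ...   | yes refl rewrite just-injective (≡-trans (sym e') e) | lookup-singleE-≡ i α | lookup-singleE-≡ j α =
            ≈M-refl _
    ...   | no ne with j' ≟ j
    ...     | yes refl = ⊥-elim (ne (inj i' i j' e' e))
    ...     | no ne' rewrite lookup-singleE-≢ α (λ x → ne (sym x)) | lookup-singleE-≢ α (λ x → ne' (sym x)) = []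
    at j' | no ne with j' ≟ j
    ...   | yes refl = ⊥-elim (ne (i , e))
    ...   | no ne' rewrite lookup-singleE-≢ α (λ x → ne' (sym x)) = []

map-suc≡just⁻ : ∀ {k} {x : Maybe (Fin k)} {y} → mapMaybe′ Data.Fin.suc x ≡ just y →
  Σ (Fin k) λ y₀ → x ≡ just y₀ × y ≡ suc y₀
map-suc≡just⁻ {x = just y₀} refl = y₀ , refl , refl

map-suc≡nothing⁻ : ∀ {k} {x : Maybe (Fin k)} → mapMaybe′ Data.Fin.suc x ≡ nothing → x ≡ nothing
map-suc≡nothing⁻ {x = nothing} refl = refl

liftM-injective : ∀ {m k} {ρ : Fin m → Maybe (Fin k)} → InjectiveWhereDefined ρ → InjectiveWhereDefined (liftM ρ)
liftM-injective inj zero zero l e₁ e₂ = refl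
liftM-injective {ρ = ρ} inj zero (suc j) l refl e₂ with map-suc≡just⁻ {x = ρ j} e₂
... | _ , _ , ()
liftM-injective {ρ = ρ} inj (suc i) zero l e₁ refl with map-suc≡just⁻ {x = ρ i} e₁
... | _ , _ , ()
liftM-injective {ρ = ρ} inj (suc i) (suc j) l e₁ e₂
  with map-suc≡just⁻ {x = ρ i} e₁ | map-suc≡just⁻ {x = ρ j} e₂
... | y₁ , p₁ , refl | y₂ , p₂ , q₂ =
  cong suc (inj i j y₁ p₁ (subst (λ z → ρ j ≡ just z) (sym (suc-injective q₂)) p₂))

Transported-liftM : ∀ {m k} {ρ : Fin m → Maybe (Fin k)} {a b as bs} → a ≈M b → Transported ρ as bs →
  Transported (liftM ρ) (a ∷ as) (b ∷ bs)
at-image (Transported-liftM p r) zero zero e = p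
at-image (Transported-liftM {ρ = ρ} p r) (suc i) j e with map-suc≡just⁻ {x = ρ i} e
... | j₀ , e₀ , refl = at-image r i j₀ e₀
off-domain (Transported-liftM {ρ = ρ} p r) (suc i) e = off-domain r i (map-suc≡nothing⁻ {x = ρ i} e)
off-image (Transported-liftM p r) zero ne = ⊥-elim (ne zero refl)
off-image (Transported-liftM p r) (suc j) ne = off-image r j (λ i e → ne (suc i) (cong (mapMaybe′ Data.Fin.suc) e))

Transported-liftM⁻ : ∀ {m k} {ρ : Fin m → Maybe (Fin k)} {a b as bs} → Transported (liftM ρ) (a ∷ as) (b ∷ bs) →
  a ≈M b × Transported ρ as bs
Transported-liftM⁻ {ρ = ρ} {as = as} {bs = bs} r = at-image r zero zero refl , r'
  where
  r' : Transported ρ as bs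
  at-image r' i j e = at-image r (suc i) (suc j) (cong (mapMaybe′ Data.Fin.suc) e)
  off-domain r' i e = off-domain r (suc i) (cong (mapMaybe′ Data.Fin.suc) e)
  off-image r' j ne = off-image r (suc j) ne'
    where
    ne' : ∀ i → liftM ρ i ≢ just (suc j)
    ne' zero ()
    ne' (suc i) e with map-suc≡just⁻ {x = ρ i} e
    ... | j₀ , e₀ , q = ne i (subst (λ z → ρ i ≡ just z) (sym (suc-injective q)) e₀)

module _ {m k : ℕ} (ρ : Fin m → Maybe (Fin k)) where

  mren-var⁻ : ∀ i {X} → mren ρ (var i) ≡ just X → Σ (Fin k) λ j → ρ i ≡ just j × X ≡ var j
  mren-var⁻ i eq with ρ i
  mren-var⁻ i refl | just j = j , refl , refl

  mren-lam⁻ : ∀ M {X} → mren ρ (lam M) ≡ just X →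
    Σ (Term (suc k)) λ M₀ → mren (liftM ρ) M ≡ just M₀ × X ≡ lam M₀
  mren-lam⁻ M eq with mren (liftM ρ) M
  mren-lam⁻ M refl | just M₀ = M₀ , refl , refl

  mren-app⁻ : ∀ M P {X} → mren ρ (app M P) ≡ just X →
    Σ (Term k) λ M₀ → Σ (List (Term k)) λ P₀ → mren ρ M ≡ just M₀ × mrenL ρ P ≡ just P₀ × X ≡ app M₀ P₀
  mren-app⁻ M P eq with mren ρ M
  ... | just M₀ with mrenL ρ P
  mren-app⁻ M P refl | just M₀ | just P₀ = M₀ , P₀ , refl , refl , refl

  mren-tbar⁻ : ∀ V {X} → mren ρ (tbar V) ≡ just X →
    Σ (List (Term k)) λ V₀ → mrenL ρ V ≡ just V₀ × X ≡ tbar V₀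
  mren-tbar⁻ V eq with mrenL ρ V
  mren-tbar⁻ V refl | just V₀ = V₀ , refl , refl

  mrenL-[]⁻ : ∀ {X} → mrenL ρ [] ≡ just X → X ≡ []
  mrenL-[]⁻ refl = refl

  mrenL-∷⁻ : ∀ L P {X} → mrenL ρ (L ∷ P) ≡ just X →
    Σ (Term k) λ L₀ → Σ (List (Term k)) λ P₀ → mren ρ L ≡ just L₀ × mrenL ρ P ≡ just P₀ × X ≡ L₀ ∷ P₀
  mrenL-∷⁻ L P eq with mren ρ L
  ... | just L₀ with mrenL ρ P
  mrenL-∷⁻ L P refl | just L₀ | just P₀ = L₀ , P₀ , refl , refl , refl

  mren-var-nothing⁻ : ∀ i → mren ρ (var i) ≡ nothing → ρ i ≡ nothing
  mren-var-nothing⁻ i eq with ρ i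
  ... | nothing = refl

  mren-lam-nothing⁻ : ∀ M → mren ρ (lam M) ≡ nothing → mren (liftM ρ) M ≡ nothing
  mren-lam-nothing⁻ M eq with mren (liftM ρ) M
  ... | nothing = refl

  mren-app-nothing⁻ : ∀ M P → mren ρ (app M P) ≡ nothing → mren ρ M ≡ nothing ⊎ mrenL ρ P ≡ nothing
  mren-app-nothing⁻ M P eq with mren ρ M
  ... | nothing = inj₁ refl
  ... | just M₀ with mrenL ρ P
  ... | nothing = inj₂ refl

  mren-tbar-nothing⁻ : ∀ V → mren ρ (tbar V) ≡ nothing → mrenL ρ V ≡ nothing
  mren-tbar-nothing⁻ V eq with mrenL ρ V
  ... | nothing = refl

  mrenL-∷-nothing⁻ : ∀ L P → mrenL ρ (L ∷ P) ≡ nothing → mren ρ L ≡ nothing ⊎ mrenL ρ P ≡ nothing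
  mrenL-∷-nothing⁻ L P eq with mren ρ L
  ... | nothing = inj₁ refl
  ... | just L₀ with mrenL ρ P
  ... | nothing = inj₂ refl

mutual
  ⟦mren⟧-reflect : ∀ {m k} (ρ : Fin m → Maybe (Fin k)) → InjectiveWhereDefined ρ → ∀ M {M'} → mren ρ M ≡ just M' →
    ∀ {bs α} → ⟦ M' ⟧ bs α → Σ (Env m) λ as → Transported ρ as bs × ⟦ M ⟧ as α
  ⟦mren⟧-reflect ρ inj (var i) eq {bs} {α} h with mren-var⁻ ρ i eq
  ... | j , e , refl = singleE i α , Transported-singleE inj e (mk {as = bs} h) , ≈E-refl (singleE i α)
  ⟦mren⟧-reflect ρ inj (lam M) eq hλ with mren-lam⁻ ρ M eq
  ... | M₀ , e , refl with hλ
  ... | b , α , q , h with ⟦mren⟧-reflect (liftM ρ) (liftM-injective inj) M e h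
  ... | (a ∷ as) , r , h' with Transported-liftM⁻ r
  ... | a≈b , r' = as , r' , b , α , q , ⟦⟧-respᴱ M h' (∷-≋ a≈b (≋-refl as))
  ⟦mren⟧-reflect ρ inj (app M P) eq {bs} h with mren-app⁻ ρ M P eq
  ... | M₀ , P₀ , e₁ , e₂ , refl with h
  ... | bs₁ , bs₂ , b , q , h₁ , h₂ with ⟦mren⟧-reflect ρ inj M e₁ h₁ | ⟦mren⟧b-reflect ρ inj P e₂ h₂
  ... | as₁ , r₁ , h₁' | as₂ , r₂ , h₂' =
    (as₁ ⊎E as₂) , Transported-respʳ (≋-sym (mk {as = bs} q)) (Transported-⊎E r₁ r₂) ,
    as₁ , as₂ , b , ≈E-refl (as₁ ⊎E as₂) , h₁' , h₂'
  ⟦mren⟧-reflect ρ inj (tbar V) eq hτ with mren-tbar⁻ ρ V eq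
  ... | V₀ , e , refl with hτ
  ... | q , h with ⟦mren⟧v-reflect ρ inj V e h
  ... | as , r , h' = as , r , q , h'

  ⟦mren⟧b-reflect : ∀ {m k} (ρ : Fin m → Maybe (Fin k)) → InjectiveWhereDefined ρ → ∀ P {P'} → mrenL ρ P ≡ just P' →
    ∀ {bs b} → ⟦ P' ⟧b bs b → Σ (Env m) λ as → Transported ρ as bs × ⟦ P ⟧b as b
  ⟦mren⟧b-reflect ρ inj [] eq {bs} h with mrenL-[]⁻ ρ eq
  ... | refl with h
  ... | q , r = emptyE , Transported-emptyE (mk {as = bs} q) , ≈E-refl emptyE , r
  ⟦mren⟧b-reflect ρ inj (L ∷ P) eq {bs} h with mrenL-∷⁻ ρ L P eq
  ... | L₀ , P₀ , e₁ , e₂ , refl with h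
  ... | bs₁ , bs₂ , β , b' , q , h₁ , h₂ , r with ⟦mren⟧-reflect ρ inj L e₁ h₁ | ⟦mren⟧b-reflect ρ inj P e₂ h₂
  ... | as₁ , r₁ , h₁' | as₂ , r₂ , h₂' =
    (as₁ ⊎E as₂) , Transported-respʳ (≋-sym (mk {as = bs} q)) (Transported-⊎E r₁ r₂) ,
    as₁ , as₂ , β , b' , ≈E-refl (as₁ ⊎E as₂) , h₁' , h₂' , r

  ⟦mren⟧v-reflect : ∀ {m k} (ρ : Fin m → Maybe (Fin k)) → InjectiveWhereDefined ρ → ∀ V {V'} → mrenL ρ V ≡ just V' →
    ∀ {bs} → ⟦ V' ⟧v bs → Σ (Env m) λ as → Transported ρ as bs × ⟦ V ⟧v as
  ⟦mren⟧v-reflect ρ inj [] eq {bs} q with mrenL-[]⁻ ρ eq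
  ... | refl = emptyE , Transported-emptyE (mk {as = bs} q) , ≈E-refl emptyE
  ⟦mren⟧v-reflect ρ inj (L ∷ V) eq {bs} h with mrenL-∷⁻ ρ L V eq
  ... | L₀ , V₀ , e₁ , e₂ , refl with h
  ... | bs₁ , bs₂ , q , h₁ , h₂ with ⟦mren⟧-reflect ρ inj L e₁ h₁ | ⟦mren⟧v-reflect ρ inj V e₂ h₂
  ... | as₁ , r₁ , h₁' | as₂ , r₂ , h₂' =
    (as₁ ⊎E as₂) , Transported-respʳ (≋-sym (mk {as = bs} q)) (Transported-⊎E r₁ r₂) ,
    as₁ , as₂ , ≈E-refl (as₁ ⊎E as₂) , h₁' , h₂'

mutual
  ⟦mren⟧-preserve : ∀ {m k} (ρ : Fin m → Maybe (Fin k)) → InjectiveWhereDefined ρ → ∀ M {M'} → mren ρ M ≡ just M' →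
    ∀ {as bs α} → Transported ρ as bs → ⟦ M ⟧ as α → ⟦ M' ⟧ bs α
  ⟦mren⟧-preserve ρ inj (var i) eq {as} r h with mren-var⁻ ρ i eq
  ... | j , e , refl = un (Transported-singleE⁻ inj e r (mk {as = as} h))
  ⟦mren⟧-preserve ρ inj (lam M) eq r (b , α , q , h) with mren-lam⁻ ρ M eq
  ... | M₀ , e , refl =
    b , α , q , ⟦mren⟧-preserve (liftM ρ) (liftM-injective inj) M e (Transported-liftM (≈M-refl b) r) h
  ⟦mren⟧-preserve ρ inj (app M P) eq {as} r (as₁ , as₂ , b , q , h₁ , h₂) with mren-app⁻ ρ M P eq
  ... | M₀ , P₀ , e₁ , e₂ , refl with Transported-split inj r (mk {as = as} q)
  ... | bs₁ , bs₂ , q' , r₁ , r₂ =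
    bs₁ , bs₂ , b , un q' , ⟦mren⟧-preserve ρ inj M e₁ r₁ h₁ , ⟦mren⟧b-preserve ρ inj P e₂ r₂ h₂
  ⟦mren⟧-preserve ρ inj (tbar V) eq r (q , h) with mren-tbar⁻ ρ V eq
  ... | V₀ , e , refl = q , ⟦mren⟧v-preserve ρ inj V e r h

  ⟦mren⟧b-preserve : ∀ {m k} (ρ : Fin m → Maybe (Fin k)) → InjectiveWhereDefined ρ → ∀ P {P'} → mrenL ρ P ≡ just P' →
    ∀ {as bs b} → Transported ρ as bs → ⟦ P ⟧b as b → ⟦ P' ⟧b bs b
  ⟦mren⟧b-preserve ρ inj [] eq {as} r (q , s) with mrenL-[]⁻ ρ eq
  ... | refl = un (Transported-emptyE⁻ r (mk {as = as} q)) , s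
  ⟦mren⟧b-preserve ρ inj (L ∷ P) eq {as} r (as₁ , as₂ , β , b' , q , h₁ , h₂ , s) with mrenL-∷⁻ ρ L P eq
  ... | L₀ , P₀ , e₁ , e₂ , refl with Transported-split inj r (mk {as = as} q)
  ... | bs₁ , bs₂ , q' , r₁ , r₂ =
    bs₁ , bs₂ , β , b' , un q' , ⟦mren⟧-preserve ρ inj L e₁ r₁ h₁ , ⟦mren⟧b-preserve ρ inj P e₂ r₂ h₂ , s

  ⟦mren⟧v-preserve : ∀ {m k} (ρ : Fin m → Maybe (Fin k)) → InjectiveWhereDefined ρ → ∀ V {V'} → mrenL ρ V ≡ just V' →
    ∀ {as bs} → Transported ρ as bs → ⟦ V ⟧v as → ⟦ V' ⟧v bs
  ⟦mren⟧v-preserve ρ inj [] eq {as} r q with mrenL-[]⁻ ρ eq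
  ... | refl = un (Transported-emptyE⁻ r (mk {as = as} q))
  ⟦mren⟧v-preserve ρ inj (L ∷ V) eq {as} r (as₁ , as₂ , q , h₁ , h₂) with mrenL-∷⁻ ρ L V eq
  ... | L₀ , V₀ , e₁ , e₂ , refl with Transported-split inj r (mk {as = as} q)
  ... | bs₁ , bs₂ , q' , r₁ , r₂ =
    bs₁ , bs₂ , un q' , ⟦mren⟧-preserve ρ inj L e₁ r₁ h₁ , ⟦mren⟧v-preserve ρ inj V e₂ r₂ h₂

≉[]-⊎Eˡ : ∀ {n} (as as₁ as₂ : Env n) i → as ≈E (as₁ ⊎E as₂) → ¬ (lookup as₁ i ≈M []) → ¬ (lookup as i ≈M [])
≉[]-⊎Eˡ as as₁ as₂ i q ne z
  with ++≈M[]⇒ˡ {lookup as₁ i} (subst (_≈M []) (lookup-⊎E as₁ as₂ i) (trans (≈M-sym (q i)) z))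
... | e = ne (subst (_≈M []) (sym e) [])

≉[]-⊎Eʳ : ∀ {n} (as as₁ as₂ : Env n) i → as ≈E (as₁ ⊎E as₂) → ¬ (lookup as₂ i ≈M []) → ¬ (lookup as i ≈M [])
≉[]-⊎Eʳ as as₁ as₂ i q ne z
  with ++≈M[]⇒ʳ {lookup as₁ i} (subst (_≈M []) (lookup-⊎E as₁ as₂ i) (trans (≈M-sym (q i)) z))
... | e = ne (subst (_≈M []) (sym e) [])

MeetsUndefined : ∀ {m k} → (Fin m → Maybe (Fin k)) → Env m → Set
MeetsUndefined {m} ρ as = Σ (Fin m) λ i → ρ i ≡ nothing × ¬ (lookup as i ≈M [])

MeetsUndefined-liftM⁻ : ∀ {m k} {ρ : Fin m → Maybe (Fin k)} {b as} →
  MeetsUndefined (liftM ρ) (b ∷ as) → MeetsUndefined ρ as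
MeetsUndefined-liftM⁻ {ρ = ρ} (suc i , e , ne) = i , map-suc≡nothing⁻ {x = ρ i} e , ne

mutual
  ⟦⟧-mren-nothing : ∀ {m k} (ρ : Fin m → Maybe (Fin k)) M → mren ρ M ≡ nothing →
    ∀ {as α} → ⟦ M ⟧ as α → MeetsUndefined ρ as
  ⟦⟧-mren-nothing ρ (var i) eq {as} {α} h =
    i , mren-var-nothing⁻ ρ i eq ,
    λ z → ∷≉M[] (trans (≈M-sym (subst (lookup as i ≈M_) (lookup-singleE-≡ i α) (h i))) z)
  ⟦⟧-mren-nothing ρ (lam M) eq (b , α , q , h) =
    MeetsUndefined-liftM⁻ {ρ = ρ} (⟦⟧-mren-nothing (liftM ρ) M (mren-lam-nothing⁻ ρ M eq) h)
  ⟦⟧-mren-nothing ρ (app M P) eq {as} (as₁ , as₂ , b , q , h₁ , h₂) with mren-app-nothing⁻ ρ M P eq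
  ... | inj₁ e with ⟦⟧-mren-nothing ρ M e h₁
  ...   | i , e' , ne = i , e' , ≉[]-⊎Eˡ as as₁ as₂ i q ne
  ⟦⟧-mren-nothing ρ (app M P) eq {as} (as₁ , as₂ , b , q , h₁ , h₂) | inj₂ e with ⟦⟧b-mren-nothing ρ P e h₂
  ...   | i , e' , ne = i , e' , ≉[]-⊎Eʳ as as₁ as₂ i q ne
  ⟦⟧-mren-nothing ρ (tbar V) eq (q , h) = ⟦⟧v-mren-nothing ρ V (mren-tbar-nothing⁻ ρ V eq) h

  ⟦⟧b-mren-nothing : ∀ {m k} (ρ : Fin m → Maybe (Fin k)) P → mrenL ρ P ≡ nothing →
    ∀ {as b} → ⟦ P ⟧b as b → MeetsUndefined ρ as
  ⟦⟧b-mren-nothing ρ (L ∷ P) eq {as} (as₁ , as₂ , β , b' , q , h₁ , h₂ , s) with mrenL-∷-nothing⁻ ρ L P eq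
  ... | inj₁ e with ⟦⟧-mren-nothing ρ L e h₁
  ...   | i , e' , ne = i , e' , ≉[]-⊎Eˡ as as₁ as₂ i q ne
  ⟦⟧b-mren-nothing ρ (L ∷ P) eq {as} (as₁ , as₂ , β , b' , q , h₁ , h₂ , s) | inj₂ e with ⟦⟧b-mren-nothing ρ P e h₂
  ...   | i , e' , ne = i , e' , ≉[]-⊎Eʳ as as₁ as₂ i q ne

  ⟦⟧v-mren-nothing : ∀ {m k} (ρ : Fin m → Maybe (Fin k)) V → mrenL ρ V ≡ nothing →
    ∀ {as} → ⟦ V ⟧v as → MeetsUndefined ρ as
  ⟦⟧v-mren-nothing ρ (L ∷ V) eq {as} (as₁ , as₂ , q , h₁ , h₂) with mrenL-∷-nothing⁻ ρ L V eq
  ... | inj₁ e with ⟦⟧-mren-nothing ρ L e h₁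
  ...   | i , e' , ne = i , e' , ≉[]-⊎Eˡ as as₁ as₂ i q ne
  ⟦⟧v-mren-nothing ρ (L ∷ V) eq {as} (as₁ , as₂ , q , h₁ , h₂) | inj₂ e with ⟦⟧v-mren-nothing ρ V e h₂
  ...   | i , e' , ne = i , e' , ≉[]-⊎Eʳ as as₁ as₂ i q ne

liftM-cong : ∀ {m k} {ρ ρ' : Fin m → Maybe (Fin k)} → (∀ i → ρ i ≡ ρ' i) → ∀ i → liftM ρ i ≡ liftM ρ' i
liftM-cong e zero    = refl
liftM-cong e (suc i) = cong (mapMaybe′ Data.Fin.suc) (e i)

mutual
  mren-cong : ∀ {m k} {ρ ρ' : Fin m → Maybe (Fin k)} → (∀ i → ρ i ≡ ρ' i) → ∀ M → mren ρ M ≡ mren ρ' M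
  mren-cong e (var i)   = cong (mapMaybe′ var) (e i)
  mren-cong e (lam M)   = cong (mapMaybe′ lam) (mren-cong (liftM-cong e) M)
  mren-cong e (app M P) rewrite mren-cong e M | mrenL-cong e P = refl
  mren-cong e (tbar V)  = cong (mapMaybe′ tbar) (mrenL-cong e V)

  mrenL-cong : ∀ {m k} {ρ ρ' : Fin m → Maybe (Fin k)} → (∀ i → ρ i ≡ ρ' i) → ∀ P → mrenL ρ P ≡ mrenL ρ' P
  mrenL-cong e []      = refl
  mrenL-cong e (L ∷ P) rewrite mren-cong e L | mrenL-cong e P = refl

liftM-just : ∀ {m k} (σ : Fin m → Fin k) i → liftM (λ j → just (σ j)) i ≡ just (liftR σ i)
liftM-just σ zero    = refl
liftM-just σ (suc i) = refl

mutual
  mren-just : ∀ {m k} (σ : Fin m → Fin k) M → mren (λ i → just (σ i)) M ≡ just (ren σ M)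
  mren-just σ (var i)   = refl
  mren-just σ (lam M)   rewrite mren-cong (liftM-just σ) M | mren-just (liftR σ) M = refl
  mren-just σ (app M P) rewrite mren-just σ M | mrenL-just σ P = refl
  mren-just σ (tbar V)  rewrite mrenL-just σ V = refl

  mrenL-just : ∀ {m k} (σ : Fin m → Fin k) P → mrenL (λ i → just (σ i)) P ≡ just (renL σ P)
  mrenL-just σ []      = refl
  mrenL-just σ (L ∷ P) rewrite mren-just σ L | mrenL-just σ P = refl

just-injective-where-defined : ∀ {m k} {σ : Fin m → Fin k} → (∀ {i j} → σ i ≡ σ j → i ≡ j) →
  InjectiveWhereDefined (λ i → just (σ i))
just-injective-where-defined σ-inj i j l e₁ e₂ = σ-inj (just-injective (≡-trans e₁ (sym e₂)))

Transported-suc⁻ : ∀ {n} {as : Env n} {c bs} → Transported (λ i → just (suc i)) as (c ∷ bs) → c ≈M [] × as ≋ bs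
Transported-suc⁻ r = off-image r zero (λ i ()) , mk λ i → at-image r i (suc i) refl

Transported-suc : ∀ {n} {c} {bs : Env n} → c ≈M [] → Transported (λ i → just (suc i)) bs (c ∷ bs)
at-image (Transported-suc p) i .(suc i) refl = ≈M-refl _
off-image (Transported-suc p) zero ne = p
off-image (Transported-suc p) (suc j) ne = ⊥-elim (ne j refl)

⟦wk⟧-reflect : ∀ {n} (N : Term n) {c bs β} → ⟦ wk N ⟧ (c ∷ bs) β → c ≈M [] × ⟦ N ⟧ bs β
⟦wk⟧-reflect N h with ⟦mren⟧-reflect _ (just-injective-where-defined suc-injective) N (mren-just suc N) h
... | as , r , h' with Transported-suc⁻ r
... | c≈[] , as≋bs = c≈[] , ⟦⟧-respᴱ N h' as≋bs

⟦wk⟧-preserve : ∀ {n} (N : Term n) {c bs β} → c ≈M [] → ⟦ N ⟧ bs β → ⟦ wk N ⟧ (c ∷ bs) β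
⟦wk⟧-preserve N p h =
  ⟦mren⟧-preserve _ (just-injective-where-defined suc-injective) N (mren-just suc N) (Transported-suc p) h

⟦wkV⟧-reflect : ∀ {n} (V : Test n) {c bs} → ⟦ renL suc V ⟧v (c ∷ bs) → c ≈M [] × ⟦ V ⟧v bs
⟦wkV⟧-reflect V h with ⟦mren⟧v-reflect _ (just-injective-where-defined suc-injective) V (mrenL-just suc V) h
... | as , r , h' with Transported-suc⁻ r
... | c≈[] , as≋bs = c≈[] , ⟦⟧v-resp V h' as≋bs

⟦wkV⟧-preserve : ∀ {n} (V : Test n) {c bs} → c ≈M [] → ⟦ V ⟧v bs → ⟦ renL suc V ⟧v (c ∷ bs)
⟦wkV⟧-preserve V p h =
  ⟦mren⟧v-preserve _ (just-injective-where-defined suc-injective) V (mrenL-just suc V) (Transported-suc p) h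

thick-injective : ∀ {n} → InjectiveWhereDefined (thick {n})
thick-injective (suc i) (suc j) l e₁ e₂ = cong suc (just-injective (≡-trans e₁ (sym e₂)))

Transported-thick : ∀ {n} (as : Env n) → Transported thick ([] ∷ as) as
at-image (Transported-thick as) (suc i) .i refl = ≈M-refl _
off-domain (Transported-thick as) zero _ = []
off-image (Transported-thick as) j ne = ⊥-elim (ne (suc j) refl)

⟦sub0⟧-reflect : ∀ {n} (M : Term (suc n)) {M' as α} → sub0 M ≡ just M' → ⟦ M' ⟧ as α → ⟦ M ⟧ ([] ∷ as) α
⟦sub0⟧-reflect M eq h with ⟦mren⟧-reflect thick thick-injective M eq h
... | (a ∷ as') , r , h' = ⟦⟧-respᴱ M h' (∷-≋ (off-domain r zero refl) (mk λ i → at-image r (suc i) i refl))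

⟦sub0⟧-preserve : ∀ {n} (M : Term (suc n)) {M' as α} → sub0 M ≡ just M' → ⟦ M ⟧ ([] ∷ as) α → ⟦ M' ⟧ as α
⟦sub0⟧-preserve M {as = as} eq h = ⟦mren⟧-preserve thick thick-injective M eq (Transported-thick as) h

sub0≡nothing⇒¬⟦⟧ : ∀ {n} (M : Term (suc n)) {as α} → sub0 M ≡ nothing → ¬ ⟦ M ⟧ ([] ∷ as) α
sub0≡nothing⇒¬⟦⟧ M eq h with ⟦⟧-mren-nothing thick M eq h
... | zero , _ , ne = ne []

-- Linear substitution

⟦_⟧Σ : ∀ {n} → List (Term n) → Env n → 𝒟 → Set
⟦_⟧Σ {n} Ms as α = Σ (Term n) λ M' → M' ∈ Ms × ⟦ M' ⟧ as α

⟦_⟧bΣ : ∀ {n} → List (Bag n) → Env n → List 𝒟 → Set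
⟦_⟧bΣ {n} Ps as b = Σ (Bag n) λ P' → P' ∈ Ps × ⟦ P' ⟧b as b

⟦_⟧vΣ : ∀ {n} → List (Test n) → Env n → Set
⟦_⟧vΣ {n} Vs as = Σ (Test n) λ V' → V' ∈ Vs × ⟦ V' ⟧v as

⊎E-regroupˡ : ∀ {n} {as e₁ e₂ f₁ f₂ : Env n} → as ≋ (e₁ ⊎E e₂) → e₁ ≋ (f₁ ⊎E f₂) → as ≋ ((f₁ ⊎E e₂) ⊎E f₂)
⊎E-regroupˡ {e₂ = e₂} {f₁} {f₂} p q = ≋-trans p (≋-trans (⊎E-cong q (≋-refl e₂)) (⊎E-rotate f₁ f₂ e₂))

⊎E-regroupʳ : ∀ {n} {as e₁ e₂ f₁ f₂ : Env n} → as ≋ (e₁ ⊎E e₂) → e₂ ≋ (f₁ ⊎E f₂) → as ≋ ((e₁ ⊎E f₁) ⊎E f₂)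
⊎E-regroupʳ {e₁ = e₁} {f₁ = f₁} {f₂} p q = ≋-trans p (≋-trans (⊎E-cong (≋-refl e₁) q) (≋-sym (⊎E-assoc e₁ f₁ f₂)))

⊎E-nestˡ : ∀ {n} {as e₁ e₂ f₁ f₂ : Env n} → as ≋ (e₁ ⊎E e₂) → e₁ ≋ (f₁ ⊎E f₂) → as ≋ (f₁ ⊎E (f₂ ⊎E e₂))
⊎E-nestˡ {e₂ = e₂} {f₁} {f₂} p q = ≋-trans p (≋-trans (⊎E-cong q (≋-refl e₂)) (⊎E-assoc f₁ f₂ e₂))

SplitAt : ∀ {n} → Fin n → Term n → Env n → (Env n → Set) → Set
SplitAt {n} x N as Q = Σ (Env n) λ as₁ → Σ (Env n) λ as₂ → Σ 𝒟 λ β →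
  as ≋ (as₁ ⊎E as₂) × Q (as₁ ⊎E singleE x β) × ⟦ N ⟧ as₂ β

mutual
  ⟦lsub⟧⁻ : ∀ {n} (x : Fin n) M N {as α} → ⟦ lsub x M N ⟧Σ as α → SplitAt x N as (λ e → ⟦ M ⟧ e α)
  ⟦lsub⟧⁻ x (var y) N {as} {α} (M' , mem , h) with x ≟ y
  ⟦lsub⟧⁻ x (var .x) N {as} {α} (.N , here refl , h) | yes refl =
    emptyE , as , α , ≋-sym (⊎E-identityˡ as) , un (⊎E-identityˡ (singleE x α)) , h
  ⟦lsub⟧⁻ x (lam M) N (M' , mem , h) with ∈-map⁻ lam mem
  ... | M₀ , mem₀ , refl with h
  ... | b , α , q , h₀ with ⟦lsub⟧⁻ (suc x) M (wk N) (M₀ , mem₀ , h₀)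
  ... | (c₁ ∷ as₁) , (c₂ ∷ as₂) , β , eq , hM , hN with ⟦wk⟧-reflect N hN
  ... | c₂≈[] , hN' = as₁ , as₂ , β , ≋-tail eq , (b , α , q , ⟦⟧-respᴱ M hM env) , hN'
    where
    env : ((c₁ ∷ as₁) ⊎E singleE (suc x) β) ≋ (b ∷ (as₁ ⊎E singleE x β))
    env = ≋-trans (⊎E-cong (≋-refl (c₁ ∷ as₁)) (singleE-suc x β))
            (∷-≋ (trans (≈M-++ (≈M-refl c₁) (≈M-sym c₂≈[])) (≈M-sym (≋-head eq))) (≋-refl _))
  ⟦lsub⟧⁻ x (app M P) N {as} (M' , mem , h) with ∈-++⁻ (map (λ M' → app M' P) (lsub x M N)) mem
  ... | inj₁ m₁ with ∈-map⁻ (λ M' → app M' P) m₁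
  ...   | M₁ , mem₁ , refl with h
  ...   | e₁ , e₂ , b , q , h₁ , h₂ with ⟦lsub⟧⁻ x M N (M₁ , mem₁ , h₁)
  ...   | f₁ , f₂ , β , eq , hM , hN =
          (f₁ ⊎E e₂) , f₂ , β , ⊎E-regroupˡ (mk {as = as} q) eq ,
          ((f₁ ⊎E singleE x β) , e₂ , b , un (⊎E-rotate f₁ e₂ (singleE x β)) , hM , h₂) , hN
  ⟦lsub⟧⁻ x (app M P) N {as} (M' , mem , h) | inj₂ m₂ with ∈-map⁻ (app M) m₂
  ...   | P₁ , mem₁ , refl with h
  ...   | e₁ , e₂ , b , q , h₁ , h₂ with ⟦lsubL⟧b⁻ x P N (P₁ , mem₁ , h₂)
  ...   | f₁ , f₂ , β , eq , hP , hN =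
          (e₁ ⊎E f₁) , f₂ , β , ⊎E-regroupʳ (mk {as = as} q) eq ,
          (e₁ , (f₁ ⊎E singleE x β) , b , un (⊎E-assoc e₁ f₁ (singleE x β)) , h₁ , hP) , hN
  ⟦lsub⟧⁻ x (tbar V) N (M' , mem , h) with ∈-map⁻ tbar mem
  ... | V₁ , mem₁ , refl with h
  ... | q , hV with ⟦lsubL⟧v⁻ x V N (V₁ , mem₁ , hV)
  ... | f₁ , f₂ , β , eq , hV' , hN = f₁ , f₂ , β , eq , (q , hV') , hN

  ⟦lsubL⟧b⁻ : ∀ {n} (x : Fin n) P N {as b} → ⟦ lsubL x P N ⟧bΣ as b → SplitAt x N as (λ e → ⟦ P ⟧b e b)
  ⟦lsubL⟧b⁻ x (L ∷ P) N {as} (P' , mem , h) with ∈-++⁻ (map (_∷ P) (lsub x L N)) mem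
  ... | inj₁ m₁ with ∈-map⁻ (_∷ P) m₁
  ...   | L₁ , mem₁ , refl with h
  ...   | e₁ , e₂ , γ , b' , q , h₁ , h₂ , r with ⟦lsub⟧⁻ x L N (L₁ , mem₁ , h₁)
  ...   | f₁ , f₂ , β , eq , hL , hN =
          (f₁ ⊎E e₂) , f₂ , β , ⊎E-regroupˡ (mk {as = as} q) eq ,
          ((f₁ ⊎E singleE x β) , e₂ , γ , b' , un (⊎E-rotate f₁ e₂ (singleE x β)) , hL , h₂ , r) , hN
  ⟦lsubL⟧b⁻ x (L ∷ P) N {as} (P' , mem , h) | inj₂ m₂ with ∈-map⁻ (L ∷_) m₂
  ...   | P₁ , mem₁ , refl with h
  ...   | e₁ , e₂ , γ , b' , q , h₁ , h₂ , r with ⟦lsubL⟧b⁻ x P N (P₁ , mem₁ , h₂)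
  ...   | f₁ , f₂ , β , eq , hP , hN =
          (e₁ ⊎E f₁) , f₂ , β , ⊎E-regroupʳ (mk {as = as} q) eq ,
          (e₁ , (f₁ ⊎E singleE x β) , γ , b' , un (⊎E-assoc e₁ f₁ (singleE x β)) , h₁ , hP , r) , hN

  ⟦lsubL⟧v⁻ : ∀ {n} (x : Fin n) V N {as} → ⟦ lsubL x V N ⟧vΣ as → SplitAt x N as (λ e → ⟦ V ⟧v e)
  ⟦lsubL⟧v⁻ x (L ∷ V) N {as} (V' , mem , h) with ∈-++⁻ (map (_∷ V) (lsub x L N)) mem
  ... | inj₁ m₁ with ∈-map⁻ (_∷ V) m₁
  ...   | L₁ , mem₁ , refl with h
  ...   | e₁ , e₂ , q , h₁ , h₂ with ⟦lsub⟧⁻ x L N (L₁ , mem₁ , h₁)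
  ...   | f₁ , f₂ , β , eq , hL , hN =
          (f₁ ⊎E e₂) , f₂ , β , ⊎E-regroupˡ (mk {as = as} q) eq ,
          ((f₁ ⊎E singleE x β) , e₂ , un (⊎E-rotate f₁ e₂ (singleE x β)) , hL , h₂) , hN
  ⟦lsubL⟧v⁻ x (L ∷ V) N {as} (V' , mem , h) | inj₂ m₂ with ∈-map⁻ (L ∷_) m₂
  ...   | V₁ , mem₁ , refl with h
  ...   | e₁ , e₂ , q , h₁ , h₂ with ⟦lsubL⟧v⁻ x V N (V₁ , mem₁ , h₂)
  ...   | f₁ , f₂ , β , eq , hV , hN =
          (e₁ ⊎E f₁) , f₂ , β , ⊎E-regroupʳ (mk {as = as} q) eq ,
          (e₁ , (f₁ ⊎E singleE x β) , un (⊎E-assoc e₁ f₁ (singleE x β)) , h₁ , hV) , hN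

lam-⊎E-singleE : ∀ {n} (x : Fin n) b β (as₁ : Env n) →
  (b ∷ (as₁ ⊎E singleE x β)) ≋ ((b ∷ as₁) ⊎E singleE (suc x) β)
lam-⊎E-singleE x b β as₁ =
  ≋-trans (∷-≋ (≈M-sym (≈M-++-identityʳ b)) (≋-refl _)) (≋-sym (⊎E-cong (≋-refl (b ∷ as₁)) (singleE-suc x β)))

mutual
  ⟦lsub⟧⁺ : ∀ {n} (x : Fin n) M N {as as₁ as₂ α β} → as ≋ (as₁ ⊎E as₂) →
    ⟦ M ⟧ (as₁ ⊎E singleE x β) α → ⟦ N ⟧ as₂ β → ⟦ lsub x M N ⟧Σ as α
  ⟦lsub⟧⁺ x (var y) N {as₁ = as₁} {as₂} eq h hN with x ≟ y
  ... | yes refl with ⊎E-singleE≋singleE⁻ x as₁ (mk h)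
  ...   | as₁≋ε , β≈α = N , here refl ,
          ⟦⟧-resp N hN (≋-sym (≋-trans eq (≋-trans (⊎E-cong as₁≋ε (≋-refl as₂)) (⊎E-identityˡ as₂)))) β≈α
  ⟦lsub⟧⁺ x (var y) N {as₁ = as₁} eq h hN | no ne = ⊥-elim (⊎E-singleE≉singleE as₁ ne (mk h))
  ⟦lsub⟧⁺ x (lam M) N {as} {as₁} {as₂} {β = β} eq (b , α , q , h) hN
    with ⟦lsub⟧⁺ (suc x) M (wk N) {b ∷ as} {b ∷ as₁} {[] ∷ as₂} (∷-≋ (≈M-sym (≈M-++-identityʳ b)) eq)
           (⟦⟧-respᴱ M h (lam-⊎E-singleE x b β as₁)) (⟦wk⟧-preserve N [] hN)
  ... | M₀ , mem , h' = lam M₀ , ∈-map⁺ lam mem , (b , α , q , h')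
  ⟦lsub⟧⁺ x (app M P) N {as₁ = as₁} {as₂} {β = β} eq (e₁ , e₂ , b , q , h₁ , h₂) hN
    with ⊎E-singleE-locate x β as₁ e₁ e₂ (mk q)
  ... | inj₁ (e₁' , e₁≋ , as₁≋) with ⟦lsub⟧⁺ x M N (≋-refl (e₁' ⊎E as₂)) (⟦⟧-respᴱ M h₁ e₁≋) hN
  ...   | M₁ , mem , hM₁ = app M₁ P , ∈-++⁺ˡ (∈-map⁺ (λ M' → app M' P) mem) ,
          ((e₁' ⊎E as₂) , e₂ , b , un (⊎E-regroupˡ eq as₁≋) , hM₁ , h₂)
  ⟦lsub⟧⁺ x (app M P) N {as₁ = as₁} {as₂} {β = β} eq (e₁ , e₂ , b , q , h₁ , h₂) hN | inj₂ (e₂' , e₂≋ , as₁≋)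
    with ⟦lsubL⟧b⁺ x P N (≋-refl (e₂' ⊎E as₂)) (⟦⟧b-resp P h₂ e₂≋ (≈M-refl b)) hN
  ...   | P₁ , mem , hP₁ = app M P₁ , ∈-++⁺ʳ (map (λ M' → app M' P) (lsub x M N)) (∈-map⁺ (app M) mem) ,
          (e₁ , (e₂' ⊎E as₂) , b , un (⊎E-nestˡ eq as₁≋) , h₁ , hP₁)
  ⟦lsub⟧⁺ x (tbar V) N eq (q , h) hN with ⟦lsubL⟧v⁺ x V N eq h hN
  ... | V₁ , mem , hV = tbar V₁ , ∈-map⁺ tbar mem , (q , hV)

  ⟦lsubL⟧b⁺ : ∀ {n} (x : Fin n) P N {as as₁ as₂ b β} → as ≋ (as₁ ⊎E as₂) →
    ⟦ P ⟧b (as₁ ⊎E singleE x β) b → ⟦ N ⟧ as₂ β → ⟦ lsubL x P N ⟧bΣ as b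
  ⟦lsubL⟧b⁺ x [] N {as₁ = as₁} {β = β} eq (q , _) hN = ⊥-elim (⊎E-singleE≉emptyE x β as₁ (mk q))
  ⟦lsubL⟧b⁺ x (L ∷ P) N {as₁ = as₁} {as₂} {β = β} eq (e₁ , e₂ , γ , b' , q , h₁ , h₂ , r) hN
    with ⊎E-singleE-locate x β as₁ e₁ e₂ (mk q)
  ... | inj₁ (e₁' , e₁≋ , as₁≋) with ⟦lsub⟧⁺ x L N (≋-refl (e₁' ⊎E as₂)) (⟦⟧-respᴱ L h₁ e₁≋) hN
  ...   | L₁ , mem , hL₁ = (L₁ ∷ P) , ∈-++⁺ˡ (∈-map⁺ (_∷ P) mem) ,
          ((e₁' ⊎E as₂) , e₂ , γ , b' , un (⊎E-regroupˡ eq as₁≋) , hL₁ , h₂ , r)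
  ⟦lsubL⟧b⁺ x (L ∷ P) N {as₁ = as₁} {as₂} {β = β} eq (e₁ , e₂ , γ , b' , q , h₁ , h₂ , r) hN | inj₂ (e₂' , e₂≋ , as₁≋)
    with ⟦lsubL⟧b⁺ x P N (≋-refl (e₂' ⊎E as₂)) (⟦⟧b-resp P h₂ e₂≋ (≈M-refl b')) hN
  ...   | P₁ , mem , hP₁ = (L ∷ P₁) , ∈-++⁺ʳ (map (_∷ P) (lsub x L N)) (∈-map⁺ (L ∷_) mem) ,
          (e₁ , (e₂' ⊎E as₂) , γ , b' , un (⊎E-nestˡ eq as₁≋) , h₁ , hP₁ , r)

  ⟦lsubL⟧v⁺ : ∀ {n} (x : Fin n) V N {as as₁ as₂ β} → as ≋ (as₁ ⊎E as₂) →
    ⟦ V ⟧v (as₁ ⊎E singleE x β) → ⟦ N ⟧ as₂ β → ⟦ lsubL x V N ⟧vΣ as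
  ⟦lsubL⟧v⁺ x [] N {as₁ = as₁} {β = β} eq q hN = ⊥-elim (⊎E-singleE≉emptyE x β as₁ (mk q))
  ⟦lsubL⟧v⁺ x (L ∷ V) N {as₁ = as₁} {as₂} {β} eq (e₁ , e₂ , q , h₁ , h₂) hN
    with ⊎E-singleE-locate x β as₁ e₁ e₂ (mk q)
  ... | inj₁ (e₁' , e₁≋ , as₁≋) with ⟦lsub⟧⁺ x L N (≋-refl (e₁' ⊎E as₂)) (⟦⟧-respᴱ L h₁ e₁≋) hN
  ...   | L₁ , mem , hL₁ = (L₁ ∷ V) , ∈-++⁺ˡ (∈-map⁺ (_∷ V) mem) ,
          ((e₁' ⊎E as₂) , e₂ , un (⊎E-regroupˡ eq as₁≋) , hL₁ , h₂)
  ⟦lsubL⟧v⁺ x (L ∷ V) N {as₁ = as₁} {as₂} {β} eq (e₁ , e₂ , q , h₁ , h₂) hN | inj₂ (e₂' , e₂≋ , as₁≋)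
    with ⟦lsubL⟧v⁺ x V N (≋-refl (e₂' ⊎E as₂)) (⟦⟧v-resp V h₂ e₂≋) hN
  ...   | V₁ , mem , hV₁ = (L ∷ V₁) , ∈-++⁺ʳ (map (_∷ V) (lsub x L N)) (∈-map⁺ (L ∷_) mem) ,
          (e₁ , (e₂' ⊎E as₂) , un (⊎E-nestˡ eq as₁≋) , h₁ , hV₁)

-- The β-rule

∈-mapMaybe⁻ : ∀ {A B : Set} (f : A → Maybe B) xs {y} → y ∈ mapMaybe f xs → Σ A λ x → x ∈ xs × f x ≡ just y
∈-mapMaybe⁻ f (x ∷ xs) mem with f x in e
... | nothing with ∈-mapMaybe⁻ f xs mem
...   | x' , m , e' = x' , there m , e'
∈-mapMaybe⁻ f (x ∷ xs) (here refl) | just y' = x , here refl , e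
∈-mapMaybe⁻ f (x ∷ xs) (there mem) | just y' with ∈-mapMaybe⁻ f xs mem
...   | x' , m , e' = x' , there m , e'

∈-mapMaybe⁺ : ∀ {A B : Set} (f : A → Maybe B) {xs x y} → x ∈ xs → f x ≡ just y → y ∈ mapMaybe f xs
∈-mapMaybe⁺ f {x ∷ xs} (here refl) e with f x
∈-mapMaybe⁺ f {x ∷ xs} (here refl) refl | just _ = here refl
∈-mapMaybe⁺ f {x' ∷ xs} (there m) e with f x'
... | nothing = ∈-mapMaybe⁺ f m e
... | just _  = there (∈-mapMaybe⁺ f m e)

≈M-middle-snoc : ∀ c β b' → (c ++ β ∷ b') ≈M ((c ++ b') ++ β ∷ [])
≈M-middle-snoc c β b' = trans (≈M-++ʳ c (≈M-++-comm (β ∷ []) b')) (≈M-sym (≡⇒≈M (++-assoc c b' (β ∷ []))))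

⊎E-singleE-zero : ∀ {n} d β (g : Env n) → ((d ∷ g) ⊎E singleE zero β) ≋ ((d ++ β ∷ []) ∷ g)
⊎E-singleE-zero d β g = ≋-trans (⊎E-cong (≋-refl (d ∷ g)) (singleE-zero β)) (∷-≋ (≈M-refl _) (⊎E-identityʳ g))

-- c is the part of the bound variable's multiset already accounted for; the β-rule starts with c = [ ].
BagSplit : ∀ {n} → List (Term (suc n)) → List 𝒟 → Env n → Bag n → 𝒟 → Set
BagSplit {n} Ms c as P α = Σ (Term (suc n)) λ M → M ∈ Ms × Σ (Env n) λ as₁ → Σ (Env n) λ as₂ → Σ (List 𝒟) λ b →
  as ≋ (as₁ ⊎E as₂) × ⟦ M ⟧ ((c ++ b) ∷ as₁) α × ⟦ P ⟧b as₂ b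

⟦lsubBag⟧⁻ : ∀ {n} (P : Bag n) Ms {c as α} → ⟦ lsubBag Ms P ⟧Σ (c ∷ as) α → BagSplit Ms c as P α
⟦lsubBag⟧⁻ [] Ms {c} {as} (M' , mem , h) =
  M' , mem , as , emptyE , [] , ≋-sym (⊎E-identityʳ as) ,
  ⟦⟧-respᴱ M' h (∷-≋ (≈M-sym (≈M-++-identityʳ c)) (≋-refl as)) , ≈E-refl emptyE , []
⟦lsubBag⟧⁻ (L ∷ P) Ms {c} {as} h with ⟦lsubBag⟧⁻ P (concatMap (λ M → lsub zero M (wk L)) Ms) h
... | M' , mem' , as₁ , as₂ , b' , eq , hM' , hP with find∈ (∈-concatMap⁻ (λ M → lsub zero M (wk L)) {xs = Ms} mem')
... | M , memM , mem with ⟦lsub⟧⁻ zero M (wk L) (M' , mem , hM')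
... | (d₁ ∷ g₁) , (d₂ ∷ g₂) , β , eqf , hM , hL with ⟦wk⟧-reflect L hL
... | d₂≈[] , hL' =
  M , memM , g₁ , (g₂ ⊎E as₂) , (β ∷ b') ,
  ⊎E-nestˡ eq (≋-tail eqf) ,
  ⟦⟧-respᴱ M hM (≋-trans (⊎E-singleE-zero d₁ β g₁) (∷-≋ head (≋-refl g₁))) ,
  (g₂ , as₂ , β , b' , ≈E-refl (g₂ ⊎E as₂) , hL' , hP , ≈M-refl _)
  where
  d₁≈ : (c ++ b') ≈M d₁
  d₁≈ = trans (≋-head eqf) (trans (≈M-++ (≈M-refl d₁) d₂≈[]) (≈M-++-identityʳ d₁))
  head : (d₁ ++ β ∷ []) ≈M (c ++ β ∷ b')
  head = trans (≈M-++ˡ (≈M-sym d₁≈) (β ∷ [])) (≈M-sym (≈M-middle-snoc c β b'))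

⟦lsubBag⟧⁺ : ∀ {n} (P : Bag n) Ms {c as as₁ as₂ b α M} → M ∈ Ms → as ≋ (as₁ ⊎E as₂) →
  ⟦ M ⟧ ((c ++ b) ∷ as₁) α → ⟦ P ⟧b as₂ b → ⟦ lsubBag Ms P ⟧Σ (c ∷ as) α
⟦lsubBag⟧⁺ [] Ms {c} {as₁ = as₁} {b = b} {M = M} mem eq hM (q , r) =
  M , mem , ⟦⟧-respᴱ M hM (∷-≋ (trans (≈M-++ʳ c r) (≈M-++-identityʳ c)) (≋-sym (⊎E-absorbʳ eq (mk q))))
⟦lsubBag⟧⁺ (L ∷ P) Ms {c} {as₁ = as₁} {as₂} {b} {M = M} mem eq hM (g₂ , as₂' , β , b' , q , hL , hP , r)
  with ⟦lsub⟧⁺ zero M (wk L) {(c ++ b') ∷ (as₁ ⊎E g₂)} {(c ++ b') ∷ as₁} {[] ∷ g₂}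
         (∷-≋ (≈M-sym (≈M-++-identityʳ (c ++ b'))) (≋-refl _)) (⟦⟧-respᴱ M hM env) (⟦wk⟧-preserve L [] hL)
  where
  env : ((c ++ b) ∷ as₁) ≋ (((c ++ b') ∷ as₁) ⊎E singleE zero β)
  env = ≋-trans (∷-≋ (trans (≈M-++ʳ c r) (≈M-middle-snoc c β b')) (≋-refl as₁))
                (≋-sym (⊎E-singleE-zero (c ++ b') β as₁))
... | M' , mem' , hM' =
  ⟦lsubBag⟧⁺ P (concatMap (λ M → lsub zero M (wk L)) Ms)
    (∈-concatMap⁺ (λ M → lsub zero M (wk L)) {xs = Ms} (lose mem mem'))
    (⊎E-regroupʳ eq (mk {as = as₂} q))
    hM' hP

⟦beta⟧-reflect : ∀ {n} (M : Term (suc n)) P {as α} →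
  ⟦ mapMaybe sub0 (lsubBag (M ∷ []) P) ⟧Σ as α → ⟦ app (lam M) P ⟧ as α
⟦beta⟧-reflect M P (M″ , mem , h) with ∈-mapMaybe⁻ sub0 (lsubBag (M ∷ []) P) mem
... | M' , mem' , e with ⟦lsubBag⟧⁻ P (M ∷ []) {c = []} (M' , mem' , ⟦sub0⟧-reflect M' e h)
... | .M , here refl , as₁ , as₂ , b , eq , hM , hP =
  as₁ , as₂ , b , un eq , (b , _ , ≈D-refl _ , hM) , hP

⟦beta⟧-preserve : ∀ {n} (M : Term (suc n)) P {as α} →
  ⟦ app (lam M) P ⟧ as α → ⟦ mapMaybe sub0 (lsubBag (M ∷ []) P) ⟧Σ as α
⟦beta⟧-preserve M P {as} (as₁ , as₂ , b , q , (b' , α' , q' , hM) , hP) with ∷D-injective {b} q'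
... | b≈b' , α≈α' with ⟦lsubBag⟧⁺ P (M ∷ []) {[]} (here refl) (mk {as = as} q)
                          (⟦⟧-resp M hM (∷-≋ (≈M-sym b≈b') (≋-refl as₁)) (≈D-sym α≈α')) hP
... | M' , mem' , hM' with sub0 M' in e
... | just M″ = M″ , ∈-mapMaybe⁺ sub0 mem' e , ⟦sub0⟧-preserve M' e hM'
... | nothing = ⊥-elim (sub0≡nothing⇒¬⟦⟧ M' e hM')

-- Invariance of the interpretation under reduction

⟦++⟧v⁻ : ∀ {n} (A B : Test n) {as} → ⟦ A ++ B ⟧v as →
  Σ (Env n) λ as₁ → Σ (Env n) λ as₂ → as ≋ (as₁ ⊎E as₂) × ⟦ A ⟧v as₁ × ⟦ B ⟧v as₂
⟦++⟧v⁻ [] B {as} h = emptyE , as , ≋-sym (⊎E-identityˡ as) , ≈E-refl emptyE , h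
⟦++⟧v⁻ (L ∷ A) B {as} (e₁ , e₂ , q , hL , h) with ⟦++⟧v⁻ A B h
... | f₁ , f₂ , eq , hA , hB =
  (e₁ ⊎E f₁) , f₂ , ⊎E-regroupʳ (mk {as = as} q) eq , (e₁ , f₁ , ≈E-refl (e₁ ⊎E f₁) , hL , hA) , hB

⟦++⟧v⁺ : ∀ {n} (A B : Test n) {as as₁ as₂} → as ≋ (as₁ ⊎E as₂) → ⟦ A ⟧v as₁ → ⟦ B ⟧v as₂ → ⟦ A ++ B ⟧v as
⟦++⟧v⁺ [] B {as₂ = as₂} eq h hB =
  ⟦⟧v-resp B hB (≋-sym (≋-trans eq (≋-trans (⊎E-cong (mk h) (≋-refl as₂)) (⊎E-identityˡ as₂))))
⟦++⟧v⁺ (L ∷ A) B {as₂ = as₂} eq (e₁ , e₂ , q , hL , hA) hB =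
  e₁ , (e₂ ⊎E as₂) , un (⊎E-nestˡ eq (mk {bs = e₁ ⊎E e₂} q)) , hL , ⟦++⟧v⁺ A B (≋-refl _) hA hB

Focus : ∀ {n} → Test n → Term n → Test n → Env n → Set
Focus {n} Q L R as = Σ (Env n) λ a → Σ (Env n) λ f₁ → Σ (Env n) λ f₂ →
  as ≋ (a ⊎E (f₁ ⊎E f₂)) × ⟦ Q ⟧v a × ⟦ L ⟧ f₁ ⋆ × ⟦ R ⟧v f₂

⟦focus⟧⁻ : ∀ {n} (Q : Test n) L R {as} → ⟦ Q ++ L ∷ R ⟧v as → Focus Q L R as
⟦focus⟧⁻ Q L R h with ⟦++⟧v⁻ Q (L ∷ R) h
... | a , a' , eq , hQ , (f₁ , f₂ , q , hL , hR) =
  a , f₁ , f₂ , ≋-trans eq (⊎E-cong (≋-refl a) (mk q)) , hQ , hL , hR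

⟦focus⟧⁺ : ∀ {n} (Q : Test n) L R {as} → Focus Q L R as → ⟦ Q ++ L ∷ R ⟧v as
⟦focus⟧⁺ Q L R (a , f₁ , f₂ , eq , hQ , hL , hR) =
  ⟦++⟧v⁺ Q (L ∷ R) eq hQ (f₁ , f₂ , ≈E-refl (f₁ ⊎E f₂) , hL , hR)

⟦⟧v-replace : ∀ {n} (Q : Test n) L L' R {as} → (∀ {e} → ⟦ L ⟧ e ⋆ → ⟦ L' ⟧ e ⋆) →
  ⟦ Q ++ L ∷ R ⟧v as → ⟦ Q ++ L' ∷ R ⟧v as
⟦⟧v-replace Q L L' R f h with ⟦focus⟧⁻ Q L R h
... | a , f₁ , f₂ , eq , hQ , hL , hR = ⟦focus⟧⁺ Q L' R (a , f₁ , f₂ , eq , hQ , f hL , hR)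

⟦⟧b-replace : ∀ {n} (Q R : Bag n) {L L'} → (∀ {e β} → ⟦ L ⟧ e β → ⟦ L' ⟧ e β) →
  ∀ {as b} → ⟦ Q ++ L ∷ R ⟧b as b → ⟦ Q ++ L' ∷ R ⟧b as b
⟦⟧b-replace [] R f (e₁ , e₂ , β , b' , q , hL , hR , r) = e₁ , e₂ , β , b' , q , f hL , hR , r
⟦⟧b-replace (K ∷ Q) R f (e₁ , e₂ , β , b' , q , hK , h , r) = e₁ , e₂ , β , b' , q , hK , ⟦⟧b-replace Q R f h , r

⟦⟧v-replace-sum : ∀ {n} (Q R : Test n) {L Ls} → (∀ {e} → ⟦ L ⟧ e ⋆ → ⟦ Ls ⟧Σ e ⋆) →
  ∀ {as} → ⟦ Q ++ L ∷ R ⟧v as → ⟦ map (λ L' → Q ++ L' ∷ R) Ls ⟧vΣ as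
⟦⟧v-replace-sum Q R {L} f h with ⟦focus⟧⁻ Q L R h
... | a , f₁ , f₂ , eq , hQ , hL , hR with f hL
... | L' , mem , hL' =
  Q ++ L' ∷ R , ∈-map⁺ (λ L' → Q ++ L' ∷ R) mem , ⟦focus⟧⁺ Q L' R (a , f₁ , f₂ , eq , hQ , hL' , hR)

⟦⟧b-replace-sum : ∀ {n} (Q R : Bag n) {L Ls} → (∀ {e β} → ⟦ L ⟧ e β → ⟦ Ls ⟧Σ e β) →
  ∀ {as b} → ⟦ Q ++ L ∷ R ⟧b as b → ⟦ map (λ L' → Q ++ L' ∷ R) Ls ⟧bΣ as b
⟦⟧b-replace-sum [] R f (e₁ , e₂ , β , b' , q , hL , hR , r) with f hL
... | L' , mem , hL' = (L' ∷ R) , ∈-map⁺ (_∷ R) mem , (e₁ , e₂ , β , b' , q , hL' , hR , r)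
⟦⟧b-replace-sum (K ∷ Q) R f (e₁ , e₂ , β , b' , q , hK , h , r) with ⟦⟧b-replace-sum Q R f h
... | P' , mem , hP' with ∈-map⁻ (λ L' → Q ++ L' ∷ R) mem
... | L' , mem' , refl =
  (K ∷ Q ++ L' ∷ R) , ∈-map⁺ (λ L' → K ∷ Q ++ L' ∷ R) mem' , (e₁ , e₂ , β , b' , q , hK , hP' , r)

⟦lam⟧-⋆⁻ : ∀ {n} (M : Term (suc n)) {as} → ⟦ lam M ⟧ as ⋆ → ⟦ M ⟧ ([] ∷ as) ⋆
⟦lam⟧-⋆⁻ M {as} (b , α , d , hM) with ∷D≈⋆⁻ (≈D-sym d)
... | b≈[] , α≈⋆ = ⟦⟧-resp M hM (∷-≋ b≈[] (≋-refl as)) α≈⋆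

⟦lam⟧-⋆⁺ : ∀ {n} (M : Term (suc n)) {as} → ⟦ M ⟧ ([] ∷ as) ⋆ → ⟦ lam M ⟧ as ⋆
⟦lam⟧-⋆⁺ M h = [] , ⋆ , ⋆≈[]∷D⋆ , h

mutual
  ⟶t-preserves : ∀ {n} {M : Term n} {Ms} → M ⟶t Ms → ∀ {as α} → ⟦ M ⟧ as α → ⟦ Ms ⟧Σ as α
  ⟶t-preserves (beta M P) h = ⟦beta⟧-preserve M P h
  ⟶t-preserves (tnil V) {as} (as₁ , as₂ , b , q , (d , hV) , (q₂ , r)) =
    tbar V , here refl , proj₂ (∷D≈⋆⁻ d) , ⟦⟧v-resp V hV (≋-sym (⊎E-absorbʳ (mk {as = as} q) (mk q₂)))
  ⟶t-preserves (tcons V L P) (as₁ , as₂ , b , q , (d , hV) , (e₁ , e₂ , β , b' , q' , _ , _ , r))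
    with ≈M[]⇒≡[] (proj₁ (∷D≈⋆⁻ d))
  ... | refl = ⊥-elim (∷≉M[] (≈M-sym r))
  ⟶t-preserves (clam st) (b , α , q , h) with ⟶t-preserves st h
  ... | M' , mem , h' = lam M' , ∈-map⁺ lam mem , (b , α , q , h')
  ⟶t-preserves (cappL P st) (as₁ , as₂ , b , q , h₁ , h₂) with ⟶t-preserves st h₁
  ... | M' , mem , h' = app M' P , ∈-map⁺ (λ M' → app M' P) mem , (as₁ , as₂ , b , q , h' , h₂)
  ⟶t-preserves (cappR M st) (as₁ , as₂ , b , q , h₁ , h₂) with ⟶b-preserves st h₂
  ... | P' , mem , h' = app M P' , ∈-map⁺ (app M) mem , (as₁ , as₂ , b , q , h₁ , h')
  ⟶t-preserves (ctbar st) (q , h) with ⟶v-preserves st h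
  ... | V' , mem , h' = tbar V' , ∈-map⁺ tbar mem , (q , h')

  ⟶b-preserves : ∀ {n} {P : Bag n} {Ps} → P ⟶b Ps → ∀ {as b} → ⟦ P ⟧b as b → ⟦ Ps ⟧bΣ as b
  ⟶b-preserves (celem Q R st) h = ⟦⟧b-replace-sum Q R (⟶t-preserves st) h

  ⟶v-preserves : ∀ {n} {V : Test n} {Vs} → V ⟶v Vs → ∀ {as} → ⟦ V ⟧v as → ⟦ Vs ⟧vΣ as
  ⟶v-preserves (tlam Q M R) h with ⟦focus⟧⁻ Q (lam M) R h
  ... | a , f₁ , f₂ , eq , hQ , hλ , hR with sub0 M in e
  ... | just M' = (Q ++ M' ∷ R) , here refl ,
        ⟦focus⟧⁺ Q M' R (a , f₁ , f₂ , eq , hQ , ⟦sub0⟧-preserve M e (⟦lam⟧-⋆⁻ M hλ) , hR)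
  ... | nothing = ⊥-elim (sub0≡nothing⇒¬⟦⟧ M e (⟦lam⟧-⋆⁻ M hλ))
  ⟶v-preserves (ttbar Q V R) h with ⟦focus⟧⁻ Q (tbar V) R h
  ... | a , f₁ , f₂ , eq , hQ , (d , hV) , hR =
    (V ++ Q ++ R) , here refl ,
    ⟦++⟧v⁺ V (Q ++ R) (⊎E-exchange eq (≋-refl (f₁ ⊎E f₂))) hV (⟦++⟧v⁺ Q R (≋-refl _) hQ hR)
  ⟶v-preserves (celem Q R st) h = ⟦⟧v-replace-sum Q R (⟶t-preserves st) h

mutual
  ⟶t-reflects : ∀ {n} {M : Term n} {Ms} → M ⟶t Ms → ∀ {as α} → ⟦ Ms ⟧Σ as α → ⟦ M ⟧ as α
  ⟶t-reflects (beta M P) h = ⟦beta⟧-reflect M P h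
  ⟶t-reflects (tnil V) {as} (.(tbar V) , here refl , (d , hV)) =
    as , emptyE , [] , un (≋-sym (⊎E-identityʳ as)) , (≈D-trans (∷D-cong [] d) (≈D-sym ⋆≈[]∷D⋆) , hV) ,
    (≈E-refl emptyE , [])
  ⟶t-reflects (clam st) (M' , mem , h) with ∈-map⁻ lam mem
  ... | M₀ , mem₀ , refl with h
  ... | b , α , q , h' = b , α , q , ⟶t-reflects st (M₀ , mem₀ , h')
  ⟶t-reflects (cappL P st) (M' , mem , h) with ∈-map⁻ (λ M' → app M' P) mem
  ... | M₀ , mem₀ , refl with h
  ... | as₁ , as₂ , b , q , h₁ , h₂ = as₁ , as₂ , b , q , ⟶t-reflects st (M₀ , mem₀ , h₁) , h₂
  ⟶t-reflects (cappR M st) (M' , mem , h) with ∈-map⁻ (app M) mem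
  ... | P₀ , mem₀ , refl with h
  ... | as₁ , as₂ , b , q , h₁ , h₂ = as₁ , as₂ , b , q , h₁ , ⟶b-reflects st (P₀ , mem₀ , h₂)
  ⟶t-reflects (ctbar st) (M' , mem , h) with ∈-map⁻ tbar mem
  ... | V₀ , mem₀ , refl with h
  ... | q , h' = q , ⟶v-reflects st (V₀ , mem₀ , h')

  ⟶b-reflects : ∀ {n} {P : Bag n} {Ps} → P ⟶b Ps → ∀ {as b} → ⟦ Ps ⟧bΣ as b → ⟦ P ⟧b as b
  ⟶b-reflects (celem Q R st) (P' , mem , h) with ∈-map⁻ (λ L' → Q ++ L' ∷ R) mem
  ... | L' , mem' , refl = ⟦⟧b-replace Q R (λ h' → ⟶t-reflects st (L' , mem' , h')) h

  ⟶v-reflects : ∀ {n} {V : Test n} {Vs} → V ⟶v Vs → ∀ {as} → ⟦ Vs ⟧vΣ as → ⟦ V ⟧v as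
  ⟶v-reflects (tlam Q M R) h with sub0 M in e
  ⟶v-reflects (tlam Q M R) (.(Q ++ M' ∷ R) , here refl , h) | just M' with ⟦focus⟧⁻ Q M' R h
  ... | a , f₁ , f₂ , eq , hQ , hM' , hR =
    ⟦focus⟧⁺ Q (lam M) R (a , f₁ , f₂ , eq , hQ , ⟦lam⟧-⋆⁺ M (⟦sub0⟧-reflect M e hM') , hR)
  ⟶v-reflects (ttbar Q V R) (.(V ++ Q ++ R) , here refl , h) with ⟦++⟧v⁻ V (Q ++ R) h
  ... | g₁ , g₂ , eq , hV , hQR with ⟦++⟧v⁻ Q R hQR
  ... | a , f₂ , eq₂ , hQ , hR =
    ⟦focus⟧⁺ Q (tbar V) R
      (a , g₁ , f₂ , ⊎E-exchange (≋-trans eq (⊎E-cong (≋-refl g₁) eq₂)) (≋-refl (a ⊎E f₂)) , hQ , (≈D-refl ⋆ , hV) , hR)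
  ⟶v-reflects (celem Q {L} R st) (V' , mem , h) with ∈-map⁻ (λ L' → Q ++ L' ∷ R) mem
  ... | L' , mem' , refl = ⟦⟧v-replace Q L' L R (λ h' → ⟶t-reflects st (L' , mem' , h')) h

-- Sums of closed tests

⊆⇒⊆S : ∀ {S T : List (Test 0)} → (∀ {x} → x ∈ S → x ∈ T) → S ⊆S T
⊆⇒⊆S f = All.tabulate (λ mem → Any.map (λ { refl → ≈L-refl _ }) (f mem))

↭⇒≈S : ∀ {S T : List (Test 0)} → S ↭ T → S ≈S T
↭⇒≈S p = ⊆⇒⊆S (↭.∈-resp-↭ p) , ⊆⇒⊆S (↭.∈-resp-↭ (↭-sym p))

⊆S-trans : ∀ {S T U} → S ⊆S T → T ⊆S U → S ⊆S U
⊆S-trans {T = T} {U} st tu = All.map step st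
  where
  step : ∀ {A} → Any (A ≈L_) T → Any (A ≈L_) U
  step a with find∈ a
  ... | B , mem , p = Any.map (trans p) (All.lookup tu mem)

⊆S-++ : ∀ {S₁ S₂ T₁ T₂} → S₁ ⊆S T₁ → S₂ ⊆S T₂ → (S₁ ++ S₂) ⊆S (T₁ ++ T₂)
⊆S-++ {T₁ = T₁} []       q = All.map (Any.++⁺ʳ T₁) q
⊆S-++              (p ∷ ps) q = Any.++⁺ˡ p ∷ ⊆S-++ ps q

≈S-refl : ∀ {S} → S ≈S S
≈S-refl = ↭⇒≈S ↭-refl

≈S-trans : ∀ {S T U} → S ≈S T → T ≈S U → S ≈S U
≈S-trans (p , q) (p' , q') = ⊆S-trans p p' , ⊆S-trans q' q

≈S-++ : ∀ {S₁ S₂ T₁ T₂} → S₁ ≈S T₁ → S₂ ≈S T₂ → (S₁ ++ S₂) ≈S (T₁ ++ T₂)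
≈S-++ (p , q) (p' , q') = ⊆S-++ p p' , ⊆S-++ q q'

Sat : List (Test 0) → Set
Sat S = Any (λ A → ⟦ A ⟧v []) S

Sat-⊆S : ∀ {S T} → S ⊆S T → Sat S → Sat T
Sat-⊆S st s with find∈ s
... | A , mem , h with find∈ (All.lookup st mem)
... | B , mem' , p = Any.map (λ { refl → ≈L⇒⟦⟧v⊆ p h }) mem'

⟦⟧vΣ⇒Sat : ∀ {S : List (Test 0)} → ⟦ S ⟧vΣ [] → Sat S
⟦⟧vΣ⇒Sat (A , mem , h) = Any.map (λ { refl → h }) mem

⟶-reflects-Sat : ∀ {S T} → S ⟶ T → Sat T → Sat S
⟶-reflects-Sat (A , As , B , (_ , S⊆) , st , (T⊆ , _)) s with Any.++⁻ As (Sat-⊆S T⊆ s)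
... | inj₁ sa = Sat-⊆S S⊆ (here (⟶v-reflects st (find∈ sa)))
... | inj₂ sb = Sat-⊆S S⊆ (there sb)

⟶-preserves-Sat : ∀ {S T} → S ⟶ T → Sat S → Sat T
⟶-preserves-Sat (A , As , B , (S⊆ , _) , st , (_ , T⊆)) s with Sat-⊆S S⊆ s
... | here h   = Sat-⊆S T⊆ (Any.++⁺ˡ (⟦⟧vΣ⇒Sat (⟶v-preserves st h)))
... | there sb = Sat-⊆S T⊆ (Any.++⁺ʳ As sb)

↠-reflects-Sat : ∀ {S T} → S ↠ T → Sat T → Sat S
↠-reflects-Sat ε*         s = s
↠-reflects-Sat (st ◅ sts) s = ⟶-reflects-Sat st (↠-reflects-Sat sts s)

↠-preserves-Sat : ∀ {S T} → S ↠ T → Sat S → Sat T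
↠-preserves-Sat ε*         s = s
↠-preserves-Sat (st ◅ sts) s = ↠-preserves-Sat sts (⟶-preserves-Sat st s)

Converges⇒⟦⟧v : ∀ {V} → Converges V → ⟦ V ⟧v []
Converges⇒⟦⟧v (T , red , (_ , ε⊆T)) with ↠-reflects-Sat red (Sat-⊆S ε⊆T (here (λ ())))
... | here h = h

⟶-congˡ : ∀ {S T} B → S ⟶ T → (S ++ B) ⟶ (T ++ B)
⟶-congˡ B (A , As , B₀ , S≈ , st , T≈) =
  A , As , (B₀ ++ B) , ≈S-++ S≈ (≈S-refl {B}) , st , ≈S-trans (≈S-++ T≈ (≈S-refl {B})) (↭⇒≈S (↭.++-assoc As B₀ B))

⟶-congʳ : ∀ {S T} B → S ⟶ T → (B ++ S) ⟶ (B ++ T)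
⟶-congʳ B (A , As , B₀ , S≈ , st , T≈) =
  A , As , (B ++ B₀) , ≈S-trans (≈S-++ (≈S-refl {B}) S≈) (↭⇒≈S (↭.shift A B B₀)) , st ,
  ≈S-trans (≈S-++ (≈S-refl {B}) T≈) (↭⇒≈S (↭.shifts B As))

↠-congˡ : ∀ {S T} B → S ↠ T → (S ++ B) ↠ (T ++ B)
↠-congˡ B ε*         = ε*
↠-congˡ B (st ◅ sts) = ⟶-congˡ B st ◅ ↠-congˡ B sts

↠-congʳ : ∀ {S T} B → S ↠ T → (B ++ S) ↠ (B ++ T)
↠-congʳ B ε*         = ε*
↠-congʳ B (st ◅ sts) = ⟶-congʳ B st ◅ ↠-congʳ B sts

Normal : List (Test 0) → Set
Normal T = T ≈S [] ⊎ T ≈S (ε ∷ [])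

NormalisingSum : List (Test 0) → Set
NormalisingSum Vs = Σ (List (Test 0)) λ T → Vs ↠ T × Normal T

Normalising : Test 0 → Set
Normalising V = NormalisingSum (V ∷ [])

ε+ε≈Sε : (ε ∷ ε ∷ []) ≈S (ε ∷ [])
ε+ε≈Sε = ⊆⇒⊆S f , ⊆⇒⊆S there
  where
  f : ∀ {x} → x ∈ (ε ∷ ε ∷ []) → x ∈ (ε ∷ [])
  f (here e)         = here e
  f (there (here e)) = here e

Normal-++ : ∀ {T₁ T₂} → Normal T₁ → Normal T₂ → Normal (T₁ ++ T₂)
Normal-++ (inj₁ p) (inj₁ q) = inj₁ (≈S-++ p q)
Normal-++ (inj₁ p) (inj₂ q) = inj₂ (≈S-++ p q)
Normal-++ (inj₂ p) (inj₁ q) = inj₂ (≈S-++ p q)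
Normal-++ (inj₂ p) (inj₂ q) = inj₂ (≈S-trans (≈S-++ p q) ε+ε≈Sε)

NormalisingSum-All : ∀ {Vs} → All Normalising Vs → NormalisingSum Vs
NormalisingSum-All [] = [] , ε* , inj₁ ≈S-refl
NormalisingSum-All {V ∷ Vs} ((T₁ , r₁ , n₁) ∷ ns) with NormalisingSum-All ns
... | T₂ , r₂ , n₂ = (T₁ ++ T₂) , (↠-congˡ Vs r₁ ◅◅ ↠-congʳ T₁ r₂) , Normal-++ n₁ n₂

Normalising-⟶v : ∀ {V Vs} → V ⟶v Vs → All Normalising Vs → Normalising V
Normalising-⟶v {V} {Vs} st ns with NormalisingSum-All ns
... | T , r , n = T , ((V , Vs , [] , ≈S-refl , st , ↭⇒≈S (↭-sym (↭.++-identityʳ Vs))) ◅ r) , n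

Normalising-⟦⟧v⇒Converges : ∀ {V} → Normalising V → ⟦ V ⟧v [] → Converges V
Normalising-⟦⟧v⇒Converges (T , r , inj₂ T≈ε) h = T , r , T≈ε
Normalising-⟦⟧v⇒Converges (T , r , inj₁ (T⊆[] , _)) h with Sat-⊆S T⊆[] (↠-preserves-Sat r (here h))
... | ()

-- Weak normalisation of closed tests

mutual
  size : ∀ {n} → Term n → ℕ
  size (var i)   = 1
  size (lam M)   = suc (size M)
  size (app M P) = suc (size M + sizeL P)
  size (tbar V)  = suc (sizeL V)

  sizeL : ∀ {n} → List (Term n) → ℕ
  sizeL []      = 0
  sizeL (L ∷ P) = size L + sizeL P

sizeL-++ : ∀ {n} (A B : List (Term n)) → sizeL (A ++ B) ≡ sizeL A + sizeL B
sizeL-++ []      B = refl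
sizeL-++ (L ∷ A) B = ≡-trans (cong (size L +_) (sizeL-++ A B)) (sym (+-assoc (size L) (sizeL A) (sizeL B)))

mutual
  mren-size : ∀ {m k} (ρ : Fin m → Maybe (Fin k)) M {M'} → mren ρ M ≡ just M' → size M' ≡ size M
  mren-size ρ (var i) eq with mren-var⁻ ρ i eq
  ... | _ , _ , refl = refl
  mren-size ρ (lam M) eq with mren-lam⁻ ρ M eq
  ... | _ , e , refl = cong suc (mren-size (liftM ρ) M e)
  mren-size ρ (app M P) eq with mren-app⁻ ρ M P eq
  ... | _ , _ , e₁ , e₂ , refl = cong suc (cong₂ _+_ (mren-size ρ M e₁) (mrenL-size ρ P e₂))
  mren-size ρ (tbar V) eq with mren-tbar⁻ ρ V eq
  ... | _ , e , refl = cong suc (mrenL-size ρ V e)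

  mrenL-size : ∀ {m k} (ρ : Fin m → Maybe (Fin k)) P {P'} → mrenL ρ P ≡ just P' → sizeL P' ≡ sizeL P
  mrenL-size ρ [] eq with mrenL-[]⁻ ρ eq
  ... | refl = refl
  mrenL-size ρ (L ∷ P) eq with mrenL-∷⁻ ρ L P eq
  ... | _ , _ , e₁ , e₂ , refl = cong₂ _+_ (mren-size ρ L e₁) (mrenL-size ρ P e₂)

wk-size : ∀ {n} (N : Term n) → size (wk N) ≡ size N
wk-size N = mren-size _ N (mren-just suc N)

suc≤+-padʳ : ∀ {h' n} h t → suc h' ≤ h + n → suc (h' + t) ≤ h + t + n
suc≤+-padʳ {h'} {n} h t le = begin
  suc h' + t    ≤⟨ +-monoˡ-≤ t le ⟩
  h + n + t     ≡⟨ xy∙z≈xz∙y h n t ⟩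
  h + t + n     ∎
  where open ≤-Reasoning

suc≤+-padˡ : ∀ {t n} h t' → suc t' ≤ t + n → suc (h + t') ≤ h + t + n
suc≤+-padˡ {t} {n} h t' le = begin
  suc (h + t')  ≡⟨ +-suc h t' ⟨
  h + suc t'    ≤⟨ +-monoʳ-≤ h le ⟩
  h + (t + n)   ≡⟨ +-assoc h t n ⟨
  h + t + n     ∎
  where open ≤-Reasoning

mutual
  lsub-size : ∀ {n} (x : Fin n) M N {M'} → M' ∈ lsub x M N → suc (size M') ≤ size M + size N
  lsub-size x (var y) N mem with x ≟ y
  lsub-size x (var y) N (here refl) | yes _ = ≤-refl
  lsub-size x (lam M) N mem with ∈-map⁻ lam mem
  ... | M₀ , mem₀ , refl =
        s≤s (subst (λ z → suc (size M₀) ≤ size M + z) (wk-size N) (lsub-size (suc x) M (wk N) mem₀))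
  lsub-size x (app M P) N mem with ∈-++⁻ (map (λ M' → app M' P) (lsub x M N)) mem
  ... | inj₁ m₁ with ∈-map⁻ (λ M' → app M' P) m₁
  ...   | M₁ , mem₁ , refl = s≤s (suc≤+-padʳ (size M) (sizeL P) (lsub-size x M N mem₁))
  lsub-size x (app M P) N mem | inj₂ m₂ with ∈-map⁻ (app M) m₂
  ...   | P₁ , mem₁ , refl = s≤s (suc≤+-padˡ (size M) (sizeL P₁) (lsubL-size x P N mem₁))
  lsub-size x (tbar V) N mem with ∈-map⁻ tbar mem
  ... | V₁ , mem₁ , refl = s≤s (lsubL-size x V N mem₁)

  lsubL-size : ∀ {n} (x : Fin n) P N {P'} → P' ∈ lsubL x P N → suc (sizeL P') ≤ sizeL P + size N
  lsubL-size x (L ∷ P) N mem with ∈-++⁻ (map (_∷ P) (lsub x L N)) mem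
  ... | inj₁ m₁ with ∈-map⁻ (_∷ P) m₁
  ...   | L₁ , mem₁ , refl = suc≤+-padʳ (size L) (sizeL P) (lsub-size x L N mem₁)
  lsubL-size x (L ∷ P) N mem | inj₂ m₂ with ∈-map⁻ (L ∷_) m₂
  ...   | P₁ , mem₁ , refl = suc≤+-padˡ (size L) (sizeL P₁) (lsubL-size x P N mem₁)

lsubBag-size : ∀ {n} (P : Bag n) Ms {M'} → M' ∈ lsubBag Ms P →
  Σ (Term (suc n)) λ M → M ∈ Ms × size M' ≤ size M + sizeL P
lsubBag-size []      Ms {M'} mem = M' , mem , ≤-reflexive (sym (+-identityʳ (size M')))
lsubBag-size (L ∷ P) Ms {M'} mem with lsubBag-size P (concatMap (λ M → lsub zero M (wk L)) Ms) mem
... | M₁ , mem₁ , le with find∈ (∈-concatMap⁻ (λ M → lsub zero M (wk L)) {xs = Ms} mem₁)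
... | M , memM , mem₂ = M , memM , (begin
  size M'                  ≤⟨ le ⟩
  size M₁ + sizeL P        ≤⟨ +-monoˡ-≤ (sizeL P) (≤-trans (n≤1+n (size M₁)) M₁<) ⟩
  size M + size L + sizeL P ≡⟨ +-assoc (size M) (size L) (sizeL P) ⟩
  size M + sizeL (L ∷ P)   ∎)
  where
  open ≤-Reasoning
  M₁< : suc (size M₁) ≤ size M + size L
  M₁< = subst (λ z → suc (size M₁) ≤ size M + z) (wk-size L) (lsub-size zero M (wk L) mem₂)

beta-size : ∀ {n} (M : Term (suc n)) P {M″} → M″ ∈ mapMaybe sub0 (lsubBag (M ∷ []) P) → size M″ < size (app (lam M) P)
beta-size M P mem with ∈-mapMaybe⁻ sub0 (lsubBag (M ∷ []) P) mem
... | M' , mem' , e with lsubBag-size P (M ∷ []) mem'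
... | .M , here refl , le = s≤s (≤-trans (≤-reflexive (mren-size thick M' e)) (≤-trans le (n≤1+n (size M + sizeL P))))

head-step : ∀ (H : Term 0) (P : Bag 0) →
  Σ (List (Term 0)) λ Ms → app H P ⟶t Ms × All (λ M' → size M' < size (app H P)) Ms
head-step (lam M)  P       = _ , beta M P , All.tabulate (beta-size M P)
head-step (tbar V) []      = _ , tnil V , s≤s (s≤s (≤-reflexive (sym (+-identityʳ (sizeL V))))) ∷ []
head-step (tbar V) (L ∷ P) = _ , tcons V L P , []
head-step (app H P') P with head-step H P'
... | Ms , st , smaller = _ , cappL P st , All.tabulate smaller'
  where
  smaller' : ∀ {M'} → M' ∈ map (λ M' → app M' P) Ms → size M' < size (app (app H P') P)
  smaller' mem with ∈-map⁻ (λ M' → app M' P) mem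
  ... | M₀ , mem₀ , refl = s≤s (+-monoˡ-≤ (sizeL P) (All.lookup smaller mem₀))

test-step : ∀ (L : Term 0) R →
  Σ (List (Test 0)) λ Vs → (L ∷ R) ⟶v Vs × All (λ V' → sizeL V' < sizeL (L ∷ R)) Vs
test-step (lam M) R = _ , tlam [] M R , All.tabulate smaller
  where
  smaller : ∀ {V'} → V' ∈ mapMaybe (λ M' → just ([] ++ M' ∷ R)) (mapMaybe sub0 (M ∷ [])) →
    sizeL V' < sizeL (lam M ∷ R)
  smaller mem with ∈-mapMaybe⁻ (λ M' → just ([] ++ M' ∷ R)) (mapMaybe sub0 (M ∷ [])) mem
  ... | M' , mem' , refl with ∈-mapMaybe⁻ sub0 (M ∷ []) mem'
  ... | .M , here refl , e = s≤s (≤-reflexive (cong (_+ sizeL R) (mren-size thick M e)))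
test-step (tbar W) R = _ , ttbar [] W R , s≤s (≤-reflexive (sizeL-++ W R)) ∷ []
test-step (app H P) R with head-step H P
... | Ms , st , smaller = _ , celem [] R st , All.tabulate smaller'
  where
  smaller' : ∀ {V'} → V' ∈ map (λ L' → [] ++ L' ∷ R) Ms → sizeL V' < sizeL (app H P ∷ R)
  smaller' mem with ∈-map⁻ (λ L' → [] ++ L' ∷ R) mem
  ... | L' , mem' , refl = +-monoˡ-≤ (sizeL R) (All.lookup smaller mem')

normalising-acc : ∀ V → Acc _<_ (sizeL V) → Normalising V
normalising-acc []      _        = (ε ∷ []) , ε* , inj₂ ≈S-refl
normalising-acc (L ∷ R) (acc rs) with test-step L R
... | Vs , st , smaller =
  Normalising-⟶v st (All.tabulate (λ {V'} mem → normalising-acc V' (rs (All.lookup smaller mem))))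

normalising : ∀ V → Normalising V
normalising V = normalising-acc V (<-wellFounded (sizeL V))

⟦⟧v⇒Converges : ∀ {V} → ⟦ V ⟧v [] → Converges V
⟦⟧v⇒Converges {V} = Normalising-⟦⟧v⇒Converges (normalising V)

-- Definability of the points of 𝒟

apps : ∀ {n} → Term n → List (Bag n) → Term n
apps H [] = H
apps H (P ∷ Ps) = apps (app H P) Ps

prepend : List (List 𝒟) → 𝒟 → 𝒟
prepend [] α = α
prepend (c ∷ s) α = c ∷D prepend s α

prepend-⋆ : ∀ s → prepend s ⋆ ≡ seq s
prepend-⋆ [] = refl
prepend-⋆ (c ∷ s) rewrite prepend-⋆ s = refl

mutual
  char : ∀ {n} → 𝒟 → Term n
  char (seq s) = charSeq s []

  charSeq : ∀ {n} → List (List 𝒟) → Test n → Term n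
  charSeq [] V = tbar V
  charSeq (b ∷ s) V = lam (charSeq s (renL suc V ++ charTest b))

  charTest : ∀ {n} → List 𝒟 → Test (suc n)
  charTest [] = []
  charTest (γ ∷ b) = probe γ ∷ charTest b

  probe : ∀ {n} → 𝒟 → Term (suc n)
  probe (seq s) = apps (var zero) (charBags s)

  charBags : ∀ {n} → List (List 𝒟) → List (Bag n)
  charBags [] = []
  charBags (c ∷ s) = charBag c ∷ charBags s

  charBag : ∀ {n} → List 𝒟 → Bag n
  charBag [] = []
  charBag (γ ∷ c) = char γ ∷ charBag c

mutual
  ⟦char⟧⁻ : ∀ {n} γ {e : Env n} {δ} → ⟦ char γ ⟧ e δ → e ≋ emptyE × δ ≈D γ
  ⟦char⟧⁻ (seq s) {e} h with ⟦charSeq⟧⁻ s [] h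
  ... | hV , d = mk {as = e} hV , d

  ⟦char⟧⁺ : ∀ {n} γ → ⟦ char γ ⟧ (emptyE {n}) γ
  ⟦char⟧⁺ (seq s) = ⟦charSeq⟧⁺ s [] (≈E-refl emptyE)

  ⟦charSeq⟧⁻ : ∀ {n} s (V : Test n) {e δ} → ⟦ charSeq s V ⟧ e δ → ⟦ V ⟧v e × δ ≈D seq s
  ⟦charSeq⟧⁻ [] V (d , hV) = hV , d
  ⟦charSeq⟧⁻ (b ∷ s) V {e} (c , δ' , q , h) with ⟦charSeq⟧⁻ s (renL suc V ++ charTest b) h
  ... | hW , d with ⟦++⟧v⁻ (renL suc V) (charTest b) hW
  ... | (c₁ ∷ e₁) , (c₂ ∷ e₂) , eq , hV' , hc with ⟦wkV⟧-reflect V hV' | ⟦charTest⟧⁻ b hc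
  ... | c₁≈ , hV | e₂≋ε , c₂≈ =
    ⟦⟧v-resp V hV (≋-sym (⊎E-absorbʳ (≋-tail eq) e₂≋ε)) ,
    ≈D-trans q (∷D-cong (trans (≋-head eq) (trans (≈M-++ c₁≈ c₂≈) (≈M-refl b))) d)

  ⟦charSeq⟧⁺ : ∀ {n} s (V : Test n) {e} → ⟦ V ⟧v e → ⟦ charSeq s V ⟧ e (seq s)
  ⟦charSeq⟧⁺ [] V hV = ≈D-refl ⋆ , hV
  ⟦charSeq⟧⁺ (b ∷ s) V {e} hV =
    b , seq s , ≈D-refl _ ,
    ⟦charSeq⟧⁺ s (renL suc V ++ charTest b) (⟦++⟧v⁺ (renL suc V) (charTest b) {as₁ = [] ∷ e} {as₂ = b ∷ emptyE}
      (∷-≋ (≈M-refl b) (≋-sym (⊎E-identityʳ e))) (⟦wkV⟧-preserve V [] hV) (⟦charTest⟧⁺ b))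

  ⟦charTest⟧⁻ : ∀ {n} b {c} {e : Env n} → ⟦ charTest b ⟧v (c ∷ e) → e ≋ emptyE × c ≈M b
  ⟦charTest⟧⁻ [] {c} {e} q = ≋-tail (mk {as = c ∷ e} q) , ≋-head (mk {as = c ∷ e} q)
  ⟦charTest⟧⁻ (γ ∷ b) {c} {e} ((c₁ ∷ e₁) , (c₂ ∷ e₂) , q , hp , hc) with ⟦probe⟧⁻ γ hp | ⟦charTest⟧⁻ b hc
  ... | e₁≋ε , c₁≈ | e₂≋ε , c₂≈ =
    ≋-trans (≋-tail (mk {as = c ∷ e} q)) (≋-trans (⊎E-cong e₁≋ε e₂≋ε) (⊎E-identityˡ emptyE)) ,
    trans (≋-head (mk {as = c ∷ e} q)) (≈M-++ c₁≈ c₂≈)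

  ⟦charTest⟧⁺ : ∀ {n} b → ⟦ charTest b ⟧v (b ∷ emptyE {n})
  ⟦charTest⟧⁺ [] = ≈E-refl ([] ∷ emptyE)
  ⟦charTest⟧⁺ (γ ∷ b) =
    ((γ ∷ []) ∷ emptyE) , (b ∷ emptyE) , un (∷-≋ (≈M-refl (γ ∷ b)) emptyE≋emptyE⊎emptyE) , ⟦probe⟧⁺ γ , ⟦charTest⟧⁺ b

  ⟦probe⟧⁻ : ∀ {n} γ {c} {e : Env n} → ⟦ probe γ ⟧ (c ∷ e) ⋆ → e ≋ emptyE × c ≈M (γ ∷ [])
  ⟦probe⟧⁻ (seq s) {c} {e} h with ⟦apps⟧⁻ (var zero) s h
  ... | hv = ≋-tail q , ≋-head q
    where
    q : (c ∷ e) ≋ ((seq s ∷ []) ∷ emptyE)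
    q = ≋-trans (mk {as = c ∷ e} hv)
          (subst (λ z → singleE zero z ≋ ((seq s ∷ []) ∷ emptyE)) (sym (prepend-⋆ s)) (singleE-zero (seq s)))

  ⟦probe⟧⁺ : ∀ {n} γ → ⟦ probe γ ⟧ ((γ ∷ []) ∷ emptyE {n}) ⋆
  ⟦probe⟧⁺ (seq s) = ⟦apps⟧⁺ (var zero) s
    (un (subst (λ z → ((seq s ∷ []) ∷ emptyE) ≋ singleE zero z) (sym (prepend-⋆ s)) (≋-sym (singleE-zero (seq s)))))

  ⟦apps⟧⁻ : ∀ {n} (H : Term n) s {e α} → ⟦ apps H (charBags s) ⟧ e α → ⟦ H ⟧ e (prepend s α)
  ⟦apps⟧⁻ H [] h = h
  ⟦apps⟧⁻ H (c ∷ s) {e} h with ⟦apps⟧⁻ (app H (charBag c)) s h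
  ... | e₁ , e₂ , b , q , hH , hB with ⟦charBag⟧⁻ c hB
  ... | e₂≋ε , b≈ = ⟦⟧-resp H hH (≋-sym (⊎E-absorbʳ (mk {as = e} q) e₂≋ε)) (∷D-cong b≈ (≈D-refl _))

  ⟦apps⟧⁺ : ∀ {n} (H : Term n) s {e α} → ⟦ H ⟧ e (prepend s α) → ⟦ apps H (charBags s) ⟧ e α
  ⟦apps⟧⁺ H [] h = h
  ⟦apps⟧⁺ H (c ∷ s) {e} h =
    ⟦apps⟧⁺ (app H (charBag c)) s (e , emptyE , c , un (≋-sym (⊎E-identityʳ e)) , h , ⟦charBag⟧⁺ c)

  ⟦charBag⟧⁻ : ∀ {n} c {e : Env n} {b} → ⟦ charBag c ⟧b e b → e ≋ emptyE × b ≈M c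
  ⟦charBag⟧⁻ [] {e} (q , r) = mk {as = e} q , r
  ⟦charBag⟧⁻ (γ ∷ c) {e} (e₁ , e₂ , β , b' , q , hT , hB , r) with ⟦char⟧⁻ γ hT | ⟦charBag⟧⁻ c hB
  ... | e₁≋ε , β≈ | e₂≋ε , b'≈ =
    ≋-trans (mk {as = e} q) (≋-trans (⊎E-cong e₁≋ε e₂≋ε) (⊎E-identityˡ emptyE)) , trans r (β≈ ∷ b'≈)

  ⟦charBag⟧⁺ : ∀ {n} c → ⟦ charBag c ⟧b (emptyE {n}) c
  ⟦charBag⟧⁺ [] = ≈E-refl emptyE , []
  ⟦charBag⟧⁺ (γ ∷ c) = emptyE , emptyE , γ , c , un emptyE≋emptyE⊎emptyE , ⟦char⟧⁺ γ , ⟦charBag⟧⁺ c , ≈M-refl (γ ∷ c)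


-- Full abstraction

mutual
  ⟦plugT⟧-mono : ∀ {n m} {M N : Term m} → M ⊆⟦⟧ N →
    ∀ (D : TCtx n m) {as α} → ⟦ plugT D M ⟧ as α → ⟦ plugT D N ⟧ as α
  ⟦plugT⟧-mono M⊆N hole {as} {α} h = M⊆N as α h
  ⟦plugT⟧-mono M⊆N (lam D) (b , α , q , h) = b , α , q , ⟦plugT⟧-mono M⊆N D h
  ⟦plugT⟧-mono M⊆N (appL D P) (as₁ , as₂ , b , q , h₁ , h₂) = as₁ , as₂ , b , q , ⟦plugT⟧-mono M⊆N D h₁ , h₂
  ⟦plugT⟧-mono M⊆N (appR M' D Ls) (as₁ , as₂ , b , q , h₁ , (e₁ , e₂ , β , b' , q' , hL , hR , r)) =
    as₁ , as₂ , b , q , h₁ , (e₁ , e₂ , β , b' , q' , ⟦plugT⟧-mono M⊆N D hL , hR , r)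
  ⟦plugT⟧-mono M⊆N (tbar C) (q , h) = q , ⟦plugV⟧-mono M⊆N C h

  ⟦plugV⟧-mono : ∀ {n m} {M N : Term m} → M ⊆⟦⟧ N →
    ∀ (C : VCtx n m) {as} → ⟦ plugV C M ⟧v as → ⟦ plugV C N ⟧v as
  ⟦plugV⟧-mono M⊆N (τctx D Ls) (e₁ , e₂ , q , hL , hR) = e₁ , e₂ , q , ⟦plugT⟧-mono M⊆N D hL , hR

⊆⟦⟧-mren : ∀ {m k} (ρ : Fin m → Maybe (Fin k)) → InjectiveWhereDefined ρ → ∀ {M N M' N'} →
  mren ρ M ≡ just M' → mren ρ N ≡ just N' → M ⊆⟦⟧ N → M' ⊆⟦⟧ N'
⊆⟦⟧-mren ρ inj {M} {N} eM eN M⊆N bs α h with ⟦mren⟧-reflect ρ inj M eM h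
... | as , r , hM = ⟦mren⟧-preserve ρ inj N eN r (M⊆N as α hM)

⊆⟦⟧⇒⊑τ : ∀ {m} (M N : Term m) → M ⊆⟦⟧ N → M ⊑τ N
⊆⟦⟧⇒⊑τ M N M⊆N ρ inj M' N' eM eN C conv =
  ⟦⟧v⇒Converges (⟦plugV⟧-mono (⊆⟦⟧-mren ρ inj eM eN M⊆N) C (Converges⇒⟦⟧v conv))

mutual
  _⊙_ : ∀ {n k j} → TCtx n k → TCtx k j → TCtx n j
  hole        ⊙ E = E
  lam D       ⊙ E = lam (D ⊙ E)
  appL D P    ⊙ E = appL (D ⊙ E) P
  appR M D Ls ⊙ E = appR M (D ⊙ E) Ls
  tbar C      ⊙ E = tbar (C ⊙V E)

  _⊙V_ : ∀ {n k j} → VCtx n k → TCtx k j → VCtx n j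
  τctx D Ls ⊙V E = τctx (D ⊙ E) Ls

mutual
  plugT-⊙ : ∀ {n k j} (D : TCtx n k) (E : TCtx k j) M → plugT (D ⊙ E) M ≡ plugT D (plugT E M)
  plugT-⊙ hole         E M = refl
  plugT-⊙ (lam D)      E M = cong lam (plugT-⊙ D E M)
  plugT-⊙ (appL D P)   E M = cong (λ z → app z P) (plugT-⊙ D E M)
  plugT-⊙ (appR M' D Ls) E M = cong (λ z → app M' (z ∷ Ls)) (plugT-⊙ D E M)
  plugT-⊙ (tbar C)     E M = cong tbar (plugV-⊙ C E M)

  plugV-⊙ : ∀ {n k j} (C : VCtx n k) (E : TCtx k j) M → plugV (C ⊙V E) M ≡ plugV C (plugT E M)
  plugV-⊙ (τctx D Ls) E M = cong (_∷ Ls) (plugT-⊙ D E M)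

lams : ∀ m → Term m → Term 0
lams zero    M = M
lams (suc m) M = lams m (lam M)

lamsC : ∀ m → TCtx 0 m
lamsC zero    = hole
lamsC (suc m) = lamsC m ⊙ lam hole

plug-lamsC : ∀ m (M : Term m) → plugT (lamsC m) M ≡ lams m M
plug-lamsC zero    M = refl
plug-lamsC (suc m) M = ≡-trans (plugT-⊙ (lamsC m) (lam hole) M) (plug-lamsC m (lam M))

appsC : ∀ {m} → TCtx 0 m → List (Bag 0) → TCtx 0 m
appsC D []       = D
appsC D (P ∷ Ps) = appsC (appL D P) Ps

plug-appsC : ∀ {m} (D : TCtx 0 m) Ps M → plugT (appsC D Ps) M ≡ apps (plugT D M) Ps
plug-appsC D []       M = refl
plug-appsC D (P ∷ Ps) M = plug-appsC (appL D P) Ps M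

abstractD : ∀ {m} → Env m → 𝒟 → 𝒟
abstractD []       α = α
abstractD (c ∷ as) α = abstractD as (c ∷D α)

abstractD-cong : ∀ {m} (as : Env m) {α α'} → α ≈D α' → abstractD as α ≈D abstractD as α'
abstractD-cong []       p = p
abstractD-cong (c ∷ as) p = abstractD-cong as (∷D-cong (≈M-refl c) p)

abstractD-injective : ∀ {m} (as as' : Env m) α α' → abstractD as α ≈D abstractD as' α' → as ≋ as' × α ≈D α'
abstractD-injective []       []         α α' p = Env0-≋ [] [] , p
abstractD-injective (c ∷ as) (c' ∷ as') α α' p with abstractD-injective as as' (c ∷D α) (c' ∷D α') p
... | as≋ , q with ∷D-injective {c} {c'} {α} {α'} q
... | c≈ , α≈ = ∷-≋ c≈ as≋ , α≈

⟦lams⟧⁻ : ∀ m (M : Term m) {δ} → ⟦ lams m M ⟧ [] δ →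
  Σ (Env m) λ as → Σ 𝒟 λ α → δ ≈D abstractD as α × ⟦ M ⟧ as α
⟦lams⟧⁻ zero    M {δ} h = [] , δ , ≈D-refl δ , h
⟦lams⟧⁻ (suc m) M h with ⟦lams⟧⁻ m (lam M) h
... | as , _ , d , (c , α , q , hM) = (c ∷ as) , α , ≈D-trans d (abstractD-cong as q) , hM

⟦lams⟧⁺ : ∀ m (M : Term m) {as α} → ⟦ M ⟧ as α → ⟦ lams m M ⟧ [] (abstractD as α)
⟦lams⟧⁺ zero    M {[]}     h = h
⟦lams⟧⁺ (suc m) M {c ∷ as} {α} h = ⟦lams⟧⁺ m (lam M) {as} (c , α , ≈D-refl _ , h)

components : 𝒟 → List (List 𝒟)
components (seq s) = s

prepend-components : ∀ δ → prepend (components δ) ⋆ ≡ δ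
prepend-components (seq s) = prepend-⋆ s

liftM-just-id : ∀ {m} (i : Fin (suc m)) → liftM just i ≡ just i
liftM-just-id zero    = refl
liftM-just-id (suc i) = refl

mutual
  mren-just-id : ∀ {m} (M : Term m) → mren just M ≡ just M
  mren-just-id (var i)   = refl
  mren-just-id (lam M)   rewrite mren-cong liftM-just-id M | mren-just-id M = refl
  mren-just-id (app M P) rewrite mren-just-id M | mrenL-just-id P = refl
  mren-just-id (tbar V)  rewrite mrenL-just-id V = refl

  mrenL-just-id : ∀ {m} (P : List (Term m)) → mrenL just P ≡ just P
  mrenL-just-id []      = refl
  mrenL-just-id (L ∷ P) rewrite mren-just-id L | mrenL-just-id P = refl

separator : ∀ {m} → Env m → 𝒟 → VCtx 0 m
separator {m} as α = τctx (appsC (lamsC m) (charBags (components (abstractD as α)))) []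

plug-separator : ∀ {m} (as : Env m) α M →
  plugV (separator as α) M ≡ apps (lams m M) (charBags (components (abstractD as α))) ∷ []
plug-separator {m} as α M
  rewrite plug-appsC (lamsC m) (charBags (components (abstractD as α))) M | plug-lamsC m M = refl

⟦separator⟧⁺ : ∀ {m} (M : Term m) {as α} → ⟦ M ⟧ as α → ⟦ plugV (separator as α) M ⟧v []
⟦separator⟧⁺ {m} M {as} {α} h = subst (λ V → ⟦ V ⟧v []) (sym (plug-separator as α M))
  ([] , [] , (λ ()) , ⟦apps⟧⁺ (lams m M) (components δ) hδ , (λ ()))
  where
  δ : 𝒟
  δ = abstractD as α
  hδ : ⟦ lams m M ⟧ [] (prepend (components δ) ⋆)
  hδ = subst (⟦ lams m M ⟧ []) (sym (prepend-components δ)) (⟦lams⟧⁺ m M h)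

⟦separator⟧⁻ : ∀ {m} (N : Term m) {as α} → ⟦ plugV (separator as α) N ⟧v [] → ⟦ N ⟧ as α
⟦separator⟧⁻ {m} N {as} {α} h with subst (λ V → ⟦ V ⟧v []) (plug-separator as α N) h
... | [] , [] , _ , hA , _
  with ⟦lams⟧⁻ m N (subst (⟦ lams m N ⟧ []) (prepend-components (abstractD as α))
                     (⟦apps⟧⁻ (lams m N) (components (abstractD as α)) hA))
... | as' , α' , d , hN with abstractD-injective as as' α α' d
... | as≋ , α≈ = ⟦⟧-resp N hN (≋-sym as≋) (≈D-sym α≈)

⊑τ⇒⊆⟦⟧ : ∀ {m} (M N : Term m) → M ⊑τ N → M ⊆⟦⟧ N
⊑τ⇒⊆⟦⟧ M N M⊑N as α h =
  ⟦separator⟧⁻ N (Converges⇒⟦⟧v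
    (M⊑N just (just-injective-where-defined (λ e → e)) M N (mren-just-id M) (mren-just-id N) (separator as α)
      (⟦⟧v⇒Converges (⟦separator⟧⁺ M h))))

theorem5p11 : ∀ {n : ℕ} (M N : Term n) → (M ⊆⟦⟧ N) ⇔ (M ⊑τ N)
theorem5p11 M N = mk⇔ (⊆⟦⟧⇒⊑τ M N) (⊑τ⇒⊆⟦⟧ M N)
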